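{- Let $(h,\gamma,\gamma')$ be a coherent triple with digit sequence $(v_i)_{i\in\mathbb Z}$, and let $\mathbb X=(X_i)_{i\in\mathbb Z}$ be a gene of length $f$. Then the gene of $(h,\gamma,\gamma')$ is $\mathbb X$ if and only if the following hold for all $i\in\mathbb Z$: if $X_i=\mathbf A$ then $v_i=0$; if $X_i=\mathbf{AB}$ then $v_i=0$; if $X_i=\mathbf B$ then $v_i=1$; if $X_i=\mathbf 0$ and $X_{i+1}=\mathbf 0$ then $1\le v_i\le p-1$; if $X_i=\mathbf 0$ and $X_{i+1}\ne\mathbf 0$ then $2\le v_i\le p-1$.
   Context: Let $p>2$ be a prime, $f\ge2$ an integer, $q=p^f$. A gene of length $f$ is a $2f$-periodic sequence $(X_i)_{i\in\mathbb Z}$ with values in the symbols $\{\mathbf A,\mathbf B,\mathbf{AB},\mathbf 0\}$ such that: if $X_i=\mathbf{AB}$ then $X_{i+1}=\mathbf 0$; if $X_i=\mathbf 0$ then $X_{i-1}\in\{\mathbf{AB},\mathbf 0\}$; and there exists $i$ with $X_i=\mathbf 0$ or $X_i\ne X_{i+f}$. A coherent triple is $(h,\gamma,\gamma')\in\mathbb Z/(q^2-1)\mathbb Z\times\mathbb Z/(q-1)\mathbb Z\times\mathbb Z/(q-1)\mathbb Z$ such that $h$ is not divisible by $q+1$ and $h\equiv\gamma+\gamma'+\frac{q-1}{p-1}\pmod{q-1}$. Gene of a coherent triple. Fix integer representatives of $h,\gamma'$. Let $h_0,\dots,h_{f-1}\in\{0,\dots,p-1\}$ with $h\equiv 1+\sum_{i=0}^{f-1}h_ip^{f-1-i}\pmod{q+1}$,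 set $h_i=p-1-h_{i-f}$ for $f\le i\le 2f-1$, extend $2f$-periodically, and set $\iota_i=1$ if $h_i=p-1$, $\iota_i=0$ otherwise. Let $\nu=p^{f-1}+\dots+p$. For $0\le i\le 2f-1$ let $\alpha_i\in\{0,\dots,q-2\}$ with $\alpha_i\equiv\lfloor p^ih/(q+1)\rfloor-p^i\gamma'\pmod{q-1}$, and set $X_i=\mathbf A$ if $\alpha_i<\frac1p\nu+\iota_{i+f}$; $X_i=\mathbf{AB}$ if $\frac1p\nu+\iota_{i+f}\le\alpha_i\le\frac{p-1}{p}\nu-\iota_i$; $X_i=\mathbf B$ if $\frac{p-1}p\nu-\iota_i<\alpha_i\le\nu$; $X_i=\mathbf 0$ if $\alpha_i>\nu$; extend $2f$-periodically. Digit sequence: $v_0,\dots,v_{2f-1}\in\{0,\dots,p-1\}$ with $h-(q+1)\gamma'\equiv\sum_{i=0}^{2f-1}v_ip^{2f-1-i}\pmod{q^2-1}$, extended $2f$-periodically. -}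

module Defs where

open import Data.Nat as ℕ using (ℕ; zero; suc; _^_; _∸_; _≤_; _<_; _≡ᵇ_; _<ᵇ_)
import Data.Nat.DivMod as ℕD
open import Data.Integer as ℤ using (ℤ; +_; _%ℕ_)
open import Data.Bool using (Bool; true; false; if_then_else_)
open import Data.Nat.Divisibility using (_∣_)
open import Data.Product using (Σ; _×_)
open import Data.Sum using (_⊎_)
open import Relation.Nullary using (¬_)
open import Relation.Binary.PropositionalEquality using (_≡_)

-- Total versions of mod / div (the divisor is always nonzero where used).
-- x %′ n : the representative of x mod n in {0,…,n-1}  (x ∈ ℤ)
_%′_ : ℤ → ℕ → ℕ
x %′ zero  = 0
x %′ suc n = x %ℕ suc n

_/′_ : ℕ → ℕ → ℕ
x /′ zero  = 0
x /′ suc n = x ℕD./ suc n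

_%ₙ_ : ℕ → ℕ → ℕ
a %ₙ n = (+ a) %′ n

data Sym : Set where
  A B AB O : Sym

record IsGene (f : ℕ) (X : ℤ → Sym) : Set where
  field
    periodic   : ∀ i → X (i ℤ.+ + (2 ℕ.* f)) ≡ X i
    ab-then-0  : ∀ i → X i ≡ AB → X (i ℤ.+ + 1) ≡ O
    0-after    : ∀ i → X i ≡ O → (X (i ℤ.- + 1) ≡ AB ⊎ X (i ℤ.- + 1) ≡ O)
    nontrivial : Σ ℤ (λ i → X i ≡ O ⊎ ¬ (X i ≡ X (i ℤ.+ + f)))

module _ (p f : ℕ) where
  q : ℕ
  q = p ^ f

  -- Coherent triple (h, γ, γ'), with h, γ, γ' given by their canonical
  -- representatives in {0,…,q²-2} resp. {0,…,q-2}.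
  record Coherent (h γ γ′ : ℕ) : Set where
    field
      h<        : h < q ℕ.* q ∸ 1
      γ<        : γ < q ∸ 1
      γ′<       : γ′ < q ∸ 1
      h-not-div : ¬ ((q ℕ.+ 1) ∣ h)
      congr     : h %ₙ (q ∸ 1) ≡ (γ ℕ.+ γ′ ℕ.+ ((q ∸ 1) /′ (p ∸ 1))) %ₙ (q ∸ 1)

  geom : ℕ → ℕ
  geom zero    = 0
  geom (suc k) = geom k ℕ.+ p ^ suc k

  ν : ℕ
  ν = geom (f ∸ 1)

  red : ℤ → ℕ
  red i = i %′ (2 ℕ.* f)

  module _ (h γ′ : ℕ) where
    S : ℕ
    S = (+ h ℤ.- + 1) %′ (q ℕ.+ 1)

    -- h_j for 0 ≤ j ≤ f-1 : the base-p digits of S, h_0 most significant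
    hlow : ℕ → ℕ
    hlow j = (S /′ (p ^ (f ∸ 1 ∸ j))) %ₙ p

    hdigit : ℤ → ℕ
    hdigit i = if red i <ᵇ f then hlow (red i) else p ∸ 1 ∸ hlow (red i ∸ f)

    ι : ℤ → ℕ
    ι i = if hdigit i ≡ᵇ (p ∸ 1) then 1 else 0

    α : ℕ → ℕ
    α j = (+ ((p ^ j ℕ.* h) /′ (q ℕ.+ 1)) ℤ.- + (p ^ j ℕ.* γ′)) %′ (q ∸ 1)

    -- ClassifiedAs a ι₀ ι_f s : the symbol s is assigned to α = a with ι_i = ι₀, ι_{i+f} = ι_f.
    -- Thresholds: (1/p)ν = ν/p and ((p-1)/p)ν = ((p-1)ν)/p are integers.
    ClassifiedAs : ℕ → ℕ → ℕ → Sym → Set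
    ClassifiedAs a ι₀ ιf A  = a < ν /′ p ℕ.+ ιf
    ClassifiedAs a ι₀ ιf AB = (ν /′ p ℕ.+ ιf ≤ a) × (+ a ℤ.≤ + (((p ∸ 1) ℕ.* ν) /′ p) ℤ.- + ι₀)
    ClassifiedAs a ι₀ ιf B  = (+ (((p ∸ 1) ℕ.* ν) /′ p) ℤ.- + ι₀ ℤ.< + a) × (a ≤ ν)
    ClassifiedAs a ι₀ ιf O  = ν < a

    GeneOfTripleIs : (ℤ → Sym) → Set
    GeneOfTripleIs X = ∀ (i : ℤ) →
      ClassifiedAs (α (red i)) (ι (+ red i)) (ι (+ (red i ℕ.+ f))) (X i)

    -- digit sequence: h - (q+1)γ' ≡ Σ_{j<2f} v_j p^{2f-1-j} (mod q²-1), extended periodically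
    N : ℕ
    N = (+ h ℤ.- + (q ℕ.+ 1) ℤ.* + γ′) %′ (q ℕ.* q ∸ 1)

    v : ℤ → ℕ
    v i = (N /′ (p ^ (2 ℕ.* f ∸ 1 ∸ red i))) %ₙ p

    DigitConditions : (ℤ → Sym) → Set
    DigitConditions X = ∀ (i : ℤ) →
        (X i ≡ A  → v i ≡ 0)
      × (X i ≡ AB → v i ≡ 0)
      × (X i ≡ B  → v i ≡ 1)
      × (X i ≡ O → X (i ℤ.+ + 1) ≡ O → (1 ≤ v i × v i ≤ p ∸ 1))
      × (X i ≡ O → ¬ (X (i ℤ.+ + 1) ≡ O) → (2 ≤ v i × v i ≤ p ∸ 1))

module Submission where

-- Write N ≡ h - (q + 1)γ′ (mod q² - 1) and W_j = p^j N mod (q² - 1) = a_j q + b_j with a_j, b_j < q.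
-- Multiplication by p rotates the 2f base-p digits of N, so v_j is the leading digit of a_j, and
-- a_j ≠ b_j because q + 1 ∤ h. Everything entering the gene of the triple is read off (a_j, b_j):
-- α_j = ⌊W_j / (q + 1)⌋ is a_j or a_j - 1, and ι_j is a digit of (S + 1)(q - 1) ≡ (q - 1)N, whose
-- rotation is (q - 1)(a_j q + b_j) ≡ (b_j - a_j)(q - 1). Comparing with the thresholds, the symbol at j
-- is determined by v_j and by whether the symbol at j + 1 is 0, exactly as the digit conditions
-- prescribe. Conversely, two sequences obeying this rule coincide: away from runs of the digit 1 the
-- zeros are fixed by v, and along a run they propagate backwards. The digits are not all 1, for then
-- a_j - b_j would be multiplied by p at each step although it is 2f-periodic and nonzero.

open import Defs
open import Data.Nat as ℕ using (ℕ; zero; suc; _+_; _*_; _∸_; _^_; _%_; _/_; _<ᵇ_; _≡ᵇ_; NonZero; z≤n; s≤s; _≤_; _<_; _≤?_; _<?_)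
open import Data.Nat.Properties
open import Data.Nat.DivMod
open import Data.Nat.Divisibility using (_∣_; divides; n∣m*n; m∣m*n; ∣m+n∣m⇒∣n)
open import Data.Nat.Primality using (Prime)
open import Data.Nat.Tactic.RingSolver using (solve-∀)
open import Data.Integer as ℤ using (ℤ; +_; -[1+_]) renaming (_+_ to _+ᶻ_; _*_ to _*ᶻ_; _-_ to _-ᶻ_; -_ to -ᶻ_)
import Data.Integer.Properties as ℤP
import Data.Integer.DivMod as ℤD
import Data.Integer.Tactic.RingSolver as ℤR
open import Data.Bool using (Bool; true; false; T)
open import Data.Unit using (tt)
open import Data.Empty using (⊥; ⊥-elim)
open import Data.Product using (_×_; _,_; proj₁; proj₂)
open import Data.Sum using (_⊎_; inj₁; inj₂; [_,_]′)
open import Relation.Nullary using (¬_; yes; no; Dec; does; contradiction)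
open import Relation.Binary using (tri<; tri≈; tri>)
open import Relation.Binary.PropositionalEquality

/′≡/ : ∀ x m .{{_ : NonZero m}} → x /′ m ≡ x / m
/′≡/ x (suc m) = refl

%ₙ≡% : ∀ x m .{{_ : NonZero m}} → x %ₙ m ≡ x % m
%ₙ≡% x (suc m) = refl

%′≡%ℕ : ∀ i m .{{_ : NonZero m}} → i %′ m ≡ i ℤ.%ℕ m
%′≡%ℕ i (suc m) = refl

x≡r+k*m⇒x%m≡r : ∀ {m} .{{_ : NonZero m}} {x r} k → r < m → x ≡ r + k * m → x % m ≡ r
x≡r+k*m⇒x%m≡r {m} {r = r} k r<m refl = trans ([m+kn]%n≡m%n r k m) (m<n⇒m%n≡m r<m)

x≡r+k*m⇒x/m≡k : ∀ {m} .{{_ : NonZero m}} {x r} k → r < m → x ≡ r + k * m → x / m ≡ k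
x≡r+k*m⇒x/m≡k {m} {r = r} k r<m refl =
  trans (+-distrib-/-∣ʳ r (n∣m*n k)) (cong₂ _+_ (m<n⇒m/n≡0 r<m) (m*n/n≡m k m))

x≡r+k*m⇒x%m≢0⇒x%m≡r : ∀ {m} .{{_ : NonZero m}} {x r} k → r ≤ m → x ≡ r + k * m → x % m ≢ 0 → x % m ≡ r
x≡r+k*m⇒x%m≢0⇒x%m≡r {m} {x} {r} k r≤m x≡ x%m≢0 with m≤n⇒m<n∨m≡n r≤m
... | inj₁ r<m = x≡r+k*m⇒x%m≡r k r<m x≡
... | inj₂ refl = ⊥-elim (x%m≢0 (trans (cong (_% m) x≡) (trans ([m+kn]%n≡m%n m k m) (n%n≡0 m))))

[m*n]%o≡[m*[n%o]]%o : ∀ m n o .{{_ : NonZero o}} → (m * n) % o ≡ (m * (n % o)) % o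
[m*n]%o≡[m*[n%o]]%o m n o = begin
  (m * n) % o                   ≡⟨ %-distribˡ-* m n o ⟩
  ((m % o) * (n % o)) % o       ≡⟨ cong (λ t → ((m % o) * t) % o) (sym (m%n%n≡m%n n o)) ⟩
  ((m % o) * ((n % o) % o)) % o ≡⟨ sym (%-distribˡ-* m (n % o) o) ⟩
  (m * (n % o)) % o             ∎
  where open ≡-Reasoning

[x+s*[n*m]]/m≡x/m+s*n : ∀ x s n m .{{_ : NonZero m}} → (x + s * (n * m)) / m ≡ x / m + s * n
[x+s*[n*m]]/m≡x/m+s*n x s n m = trans (+-distrib-/-∣ʳ x (divides (s * n) (sym (*-assoc s n m))))
  (cong (λ t → x / m + t) (trans (cong (_/ m) (sym (*-assoc s n m))) (m*n/n≡m (s * n) m)))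

+[r+k*m]≡+r+ᶻ+k*ᶻ+m : ∀ r k m → + (r + k * m) ≡ + r +ᶻ + k *ᶻ + m
+[r+k*m]≡+r+ᶻ+k*ᶻ+m r k m = trans (ℤP.pos-+ r (k * m)) (cong (+ r +ᶻ_) (ℤP.pos-* k m))

+y≡+r+k*m⇒y%m≡r : ∀ {m} .{{_ : NonZero m}} {y r} (k : ℤ) → r < m → + y ≡ + r +ᶻ k *ᶻ + m → y % m ≡ r
+y≡+r+k*m⇒y%m≡r {suc m} {r = r} (+ k) r<m eq =
  x≡r+k*m⇒x%m≡r k r<m (ℤP.+-injective (trans eq (sym (+[r+k*m]≡+r+ᶻ+k*ᶻ+m r k (suc m)))))
+y≡+r+k*m⇒y%m≡r {suc m} {y} {r} -[1+ d ] (s≤s r≤m) eq with negative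
  where
  r≤k : r ≤ m + d * suc m
  r≤k = ≤-trans r≤m (m≤m+n m _)
  negative : + y ≡ -[1+ (m + d * suc m ∸ r) ]
  negative = trans eq (trans (ℤP.⊖-< (s≤s r≤k)) (cong (λ x → -ᶻ (+ x)) (+-∸-assoc 1 r≤k)))
... | ()

+x≡+y+k*m⇒x%m≡y%m : ∀ {m} .{{_ : NonZero m}} x y (k : ℤ) → + x ≡ + y +ᶻ k *ᶻ + m → x % m ≡ y % m
+x≡+y+k*m⇒x%m≡y%m {m} x y k eq = +y≡+r+k*m⇒y%m≡r (k +ᶻ + (y / m)) (m%n<n y m) (begin
    + x                                ≡⟨ eq ⟩
    + y +ᶻ k *ᶻ + m                    ≡⟨ cong (λ t → t +ᶻ k *ᶻ + m) (trans (cong +_ (m≡m%n+[m/n]*n y m)) (+[r+k*m]≡+r+ᶻ+k*ᶻ+m (y % m) (y / m) m)) ⟩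
    + (y % m) +ᶻ + (y / m) *ᶻ + m +ᶻ k *ᶻ + m ≡⟨ regroup (+ (y % m)) (+ (y / m)) (+ m) k ⟩
    + (y % m) +ᶻ (k +ᶻ + (y / m)) *ᶻ + m ∎)
  where
  open ≡-Reasoning
  regroup : ∀ a b c d → a +ᶻ b *ᶻ c +ᶻ d *ᶻ c ≡ a +ᶻ (d +ᶻ b) *ᶻ c
  regroup = ℤR.solve-∀

+x≡+r+k*m⇒+[x/m]≡k : ∀ {m} .{{_ : NonZero m}} {x r} (k : ℤ) → r < m → + x ≡ + r +ᶻ k *ᶻ + m → + (x / m) ≡ k
+x≡+r+k*m⇒+[x/m]≡k {m} {x} {r} k r<m eq = ℤP.*-cancelʳ-≡ (+ (x / m)) k (+ m) (cancel (+ r) (begin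
  + r +ᶻ + (x / m) *ᶻ + m ≡⟨ cong (λ t → + t +ᶻ + (x / m) *ᶻ + m) (sym (+y≡+r+k*m⇒y%m≡r k r<m eq)) ⟩
  + (x % m) +ᶻ + (x / m) *ᶻ + m ≡⟨ sym (+[r+k*m]≡+r+ᶻ+k*ᶻ+m (x % m) (x / m) m) ⟩
  + (x % m + x / m * m)   ≡⟨ cong +_ (sym (m≡m%n+[m/n]*n x m)) ⟩
  + x                     ≡⟨ eq ⟩
  + r +ᶻ k *ᶻ + m         ∎))
  where
  open ≡-Reasoning
  unshift : ∀ a x → x ≡ (a +ᶻ x) -ᶻ a
  unshift = ℤR.solve-∀
  cancel : ∀ a {x y} → a +ᶻ x ≡ a +ᶻ y → x ≡ y
  cancel a {x} {y} eq = trans (unshift a x) (trans (cong (_-ᶻ a) eq) (sym (unshift a y)))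

i≡+r+k*m⇒i%ℕm≡r : ∀ (i : ℤ) {m} .{{_ : NonZero m}} r (k : ℤ) → r < m → i ≡ + r +ᶻ k *ᶻ + m → i ℤ.%ℕ m ≡ r
i≡+r+k*m⇒i%ℕm≡r i {m} r k r<m eq =
  trans (sym (m<n⇒m%n≡m (ℤD.n%ℕd<d i m))) (+y≡+r+k*m⇒y%m≡r (k -ᶻ i ℤ./ℕ m) r<m (begin
    + s                                  ≡⟨ shift (+ s) (i ℤ./ℕ m) (+ m) ⟩
    + s +ᶻ i ℤ./ℕ m *ᶻ + m -ᶻ i ℤ./ℕ m *ᶻ + m ≡⟨ cong (_-ᶻ i ℤ./ℕ m *ᶻ + m) (trans (sym (ℤD.a≡a%ℕn+[a/ℕn]*n i m)) eq) ⟩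
    + r +ᶻ k *ᶻ + m -ᶻ i ℤ./ℕ m *ᶻ + m   ≡⟨ regroup (+ r) k (i ℤ./ℕ m) (+ m) ⟩
    + r +ᶻ (k -ᶻ i ℤ./ℕ m) *ᶻ + m ∎))
  where
  open ≡-Reasoning
  s = i ℤ.%ℕ m
  shift : ∀ a b c → a ≡ a +ᶻ b *ᶻ c -ᶻ b *ᶻ c
  shift = ℤR.solve-∀
  regroup : ∀ r k l m → r +ᶻ k *ᶻ m -ᶻ l *ᶻ m ≡ r +ᶻ (k -ᶻ l) *ᶻ m
  regroup = ℤR.solve-∀

[i+t]%ℕm≡[i%ℕm+t]%m : ∀ i t m .{{_ : NonZero m}} → (i +ᶻ + t) ℤ.%ℕ m ≡ (i ℤ.%ℕ m + t) % m
[i+t]%ℕm≡[i%ℕm+t]%m i t m =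
  i≡+r+k*m⇒i%ℕm≡r (i +ᶻ + t) ((e + t) % m) (+ ((e + t) / m) +ᶻ k) (m%n<n (e + t) m) (begin
    i +ᶻ + t                                  ≡⟨ cong (_+ᶻ + t) (ℤD.a≡a%ℕn+[a/ℕn]*n i m) ⟩
    + e +ᶻ k *ᶻ + m +ᶻ + t                    ≡⟨ swap (+ e) k (+ m) (+ t) ⟩
    + e +ᶻ + t +ᶻ k *ᶻ + m                    ≡⟨ cong (_+ᶻ k *ᶻ + m) (sym (ℤP.pos-+ e t)) ⟩
    + (e + t) +ᶻ k *ᶻ + m                     ≡⟨ cong (λ x → x +ᶻ k *ᶻ + m) (trans (cong +_ (m≡m%n+[m/n]*n (e + t) m))
                                                    (+[r+k*m]≡+r+ᶻ+k*ᶻ+m ((e + t) % m) ((e + t) / m) m)) ⟩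
    + ((e + t) % m) +ᶻ + ((e + t) / m) *ᶻ + m +ᶻ k *ᶻ + m ≡⟨ regroup (+ ((e + t) % m)) (+ ((e + t) / m)) k (+ m) ⟩
    + ((e + t) % m) +ᶻ (+ ((e + t) / m) +ᶻ k) *ᶻ + m ∎)
  where
  open ≡-Reasoning
  e = i ℤ.%ℕ m
  k = i ℤ./ℕ m
  swap : ∀ a b c d → a +ᶻ b *ᶻ c +ᶻ d ≡ a +ᶻ d +ᶻ b *ᶻ c
  swap = ℤR.solve-∀
  regroup : ∀ a b c d → a +ᶻ b *ᶻ d +ᶻ c *ᶻ d ≡ a +ᶻ (b +ᶻ c) *ᶻ d
  regroup = ℤR.solve-∀

[i+1]+t≡i+[1+t] : ∀ i t → (i +ᶻ + 1) +ᶻ + t ≡ i +ᶻ + suc t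
[i+1]+t≡i+[1+t] i t = trans (ℤP.+-assoc i (+ 1) (+ t)) (cong (i +ᶻ_) (sym (ℤP.pos-+ 1 t)))

[i+1]-1≡i : ∀ i → (i +ᶻ + 1) -ᶻ + 1 ≡ i
[i+1]-1≡i = ℤR.solve-∀

2+[k*l+c]≤k*u : ∀ {k l u c} → l < u → c < k → 2 + (l + c * u) ≤ k * u → 2 + (k * l + c) ≤ k * u
2+[k*l+c]≤k*u {k} {l} {u} {c} l<u c<k le with suc l <? u
... | yes 1+l<u = begin
  2 + (k * l + c)   ≡⟨ cong suc (sym (+-suc (k * l) c)) ⟩
  suc (k * l + suc c) ≤⟨ s≤s (+-monoʳ-≤ (k * l) c<k) ⟩
  suc (k * l + k)   ≡⟨ cong suc (trans (+-comm (k * l) k) (sym (*-suc k l))) ⟩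
  suc (k * suc l)   ≤⟨ *-monoʳ-< k {{ℕ.>-nonZero (≤-trans (s≤s z≤n) c<k)}} 1+l<u ⟩
  k * u             ∎
  where open ≤-Reasoning
... | no 1+l≮u = begin
  2 + (k * l + c)   ≡⟨ sym (trans (+-suc (k * l) (suc c)) (cong suc (+-suc (k * l) c))) ⟩
  k * l + suc (suc c) ≤⟨ +-monoʳ-≤ (k * l) 2+c≤k ⟩
  k * l + k         ≡⟨ trans (+-comm (k * l) k) (sym (*-suc k l)) ⟩
  k * suc l         ≡⟨ cong (k *_) 1+l≡u ⟩
  k * u             ∎
  where
  open ≤-Reasoning
  1+l≡u : suc l ≡ u
  1+l≡u = ≤-antisym l<u (≮⇒≥ 1+l≮u)
  2+c≤k : suc (suc c) ≤ k
  2+c≤k = *-cancelʳ-< u (suc c) k (≤-trans (≤-reflexive (cong (λ t → suc (t + c * u)) (sym 1+l≡u))) le)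

[k*x]%m≡k*[x%n]+x/n : ∀ k n m .{{_ : NonZero n}} .{{_ : NonZero m}} → suc m ≡ k * n →
  ∀ x → x < m → (k * x) % m ≡ k * (x % n) + x / n
[k*x]%m≡k*[x%n]+x/n k n m 1+m≡kn x x<m = x≡r+k*m⇒x%m≡r c r<m (begin
  k * x               ≡⟨ cong (k *_) x≡ ⟩
  k * (l + c * n)     ≡⟨ distrib k l c n ⟩
  k * l + c * (k * n) ≡⟨ cong (λ t → k * l + c * t) (sym 1+m≡kn) ⟩
  k * l + c * suc m   ≡⟨ shift (k * l) c m ⟩
  k * l + c + c * m   ∎)
  where
  open ≡-Reasoning
  l = x % n
  c = x / n
  distrib : ∀ k l c n → k * (l + c * n) ≡ k * l + c * (k * n)
  distrib = solve-∀
  shift : ∀ a c m → a + c * suc m ≡ (a + c) + c * m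
  shift = solve-∀
  x≡ : x ≡ l + c * n
  x≡ = m≡m%n+[m/n]*n x n
  r<m : k * l + c < m
  r<m = ≤-pred (subst (λ t → 2 + (k * l + c) ≤ t) (sym 1+m≡kn) (2+[k*l+c]≤k*u {k} {l} {n} {c} (m%n<n x n)
          (m<n*o⇒m/o<n {x} {k} {n} (subst (x <_) 1+m≡kn (≤-trans x<m (n≤1+n m))))
          (≤-trans (≤-reflexive (cong (λ t → 2 + t) (sym x≡))) (≤-trans (s≤s x<m) (≤-reflexive 1+m≡kn)))))

-- Multiplication by k modulo k·b·u - 1 moves the base-b digit of x at place u up to place k·u.
[k*x%m]/[k*u]≡[x/u]%b : ∀ b k u m .{{_ : NonZero b}} .{{_ : NonZero k}} .{{_ : NonZero u}} .{{_ : NonZero m}}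
  .{{_ : NonZero (k * u)}} → suc m ≡ k * (b * u) → ∀ x → x < m → ((k * x) % m) / (k * u) ≡ (x / u) % b
[k*x%m]/[k*u]≡[x/u]%b b k u m 1+m≡kbu x x<m = begin-equality
  ((k * x) % m) / (k * u)  ≡⟨ /-congˡ ([k*x]%m≡k*[x%n]+x/n k (b * u) m {{bu≢0}} 1+m≡kbu x x<m) ⟩
  (k * l + c) / (k * u)    ≡⟨ x≡r+k*m⇒x/m≡k (l / u) low<ku l≡ ⟩
  l / u                    ≡⟨ m%[n*o]/o≡m/o%n x b u ⟩
  (x / u) % b              ∎
  where
  open ≤-Reasoning
  instance
    bu≢0 : NonZero (b * u)
    bu≢0 = m*n≢0 b u
  l = x % (b * u)
  c = x / (b * u)
  c<k : c < k
  c<k = m<n*o⇒m/o<n (subst (x <_) 1+m≡kbu (≤-trans x<m (n≤1+n m)))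
  regroup : ∀ k l′ d u c → k * (l′ + d * u) + c ≡ (k * l′ + c) + d * (k * u)
  regroup = solve-∀
  l≡ : k * l + c ≡ (k * (l % u) + c) + l / u * (k * u)
  l≡ = trans (cong (λ t → k * t + c) (m≡m%n+[m/n]*n l u)) (regroup k (l % u) (l / u) u c)
  low<ku : k * (l % u) + c < k * u
  low<ku = begin-strict
    k * (l % u) + c ≡⟨ +-comm (k * (l % u)) c ⟩
    c + k * (l % u) <⟨ +-monoˡ-< (k * (l % u)) c<k ⟩
    k + k * (l % u) ≡⟨ sym (*-suc k (l % u)) ⟩
    k * suc (l % u) ≤⟨ *-monoʳ-≤ k (m%n<n l u) ⟩
    k * u           ∎

n*m∸1∸s≡[n∸1∸s/m]*m+[m∸1∸s%m] : ∀ n m s .{{_ : NonZero m}} → s < n * m →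
  n * m ∸ 1 ∸ s ≡ (n ∸ 1 ∸ s / m) * m + (m ∸ 1 ∸ s % m)
n*m∸1∸s≡[n∸1∸s/m]*m+[m∸1∸s%m] n m s s<nm
  with m≤n⇒∃[o]m+o≡n (m<n*o⇒m/o<n {s} {n} {m} s<nm) | m≤n⇒∃[o]m+o≡n (m%n<n s m)
... | k , t+1+k≡n | j , ρ+1+j≡m = begin
  n * m ∸ 1 ∸ s                             ≡⟨ cong (λ x → x ∸ 1 ∸ s) nm≡ ⟩
  suc (s + (k * m + j)) ∸ 1 ∸ s             ≡⟨ m+n∸m≡n s (k * m + j) ⟩
  k * m + j                                 ≡⟨ cong₂ (λ x y → x * m + y) (sym k≡) (sym j≡) ⟩
  (n ∸ 1 ∸ s / m) * m + (m ∸ 1 ∸ s % m)     ∎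
  where
  open ≡-Reasoning
  t = s / m
  ρ = s % m
  k≡ : n ∸ 1 ∸ t ≡ k
  k≡ = trans (cong (λ x → x ∸ 1 ∸ t) (sym t+1+k≡n)) (m+n∸m≡n t k)
  j≡ : m ∸ 1 ∸ ρ ≡ j
  j≡ = trans (cong (λ x → x ∸ 1 ∸ ρ) (sym ρ+1+j≡m)) (m+n∸m≡n ρ j)
  expand : ∀ t k ρ j → suc (t + k) * suc (ρ + j) ≡ suc ((ρ + t * suc (ρ + j)) + (k * suc (ρ + j) + j))
  expand = solve-∀
  nm≡ : n * m ≡ suc (s + (k * m + j))
  nm≡ = begin
    n * m                                              ≡⟨ cong₂ _*_ (sym t+1+k≡n) (sym ρ+1+j≡m) ⟩
    suc (t + k) * suc (ρ + j)                          ≡⟨ expand t k ρ j ⟩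
    suc ((ρ + t * suc (ρ + j)) + (k * suc (ρ + j) + j)) ≡⟨ cong (λ x → suc ((ρ + t * x) + (k * x + j))) ρ+1+j≡m ⟩
    suc ((ρ + t * m) + (k * m + j))                    ≡⟨ cong (λ x → suc (x + (k * m + j))) (sym (m≡m%n+[m/n]*n s m)) ⟩
    suc (s + (k * m + j))                              ∎

m∸1∸x<m : ∀ m x .{{_ : NonZero m}} → m ∸ 1 ∸ x < m
m∸1∸x<m (suc m) x = s≤s (m∸n≤m m x)

[n*m∸1∸s]/m≡n∸1∸s/m : ∀ n m s .{{_ : NonZero m}} → s < n * m → (n * m ∸ 1 ∸ s) / m ≡ n ∸ 1 ∸ s / m
[n*m∸1∸s]/m≡n∸1∸s/m n m s s<nm = x≡r+k*m⇒x/m≡k (n ∸ 1 ∸ s / m) (m∸1∸x<m m (s % m))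
  (trans (n*m∸1∸s≡[n∸1∸s/m]*m+[m∸1∸s%m] n m s s<nm) (+-comm _ (m ∸ 1 ∸ s % m)))

[n*m∸1∸s]%m≡m∸1∸s%m : ∀ n m s .{{_ : NonZero m}} → s < n * m → (n * m ∸ 1 ∸ s) % m ≡ m ∸ 1 ∸ s % m
[n*m∸1∸s]%m≡m∸1∸s%m n m s s<nm = x≡r+k*m⇒x%m≡r (n ∸ 1 ∸ s / m) (m∸1∸x<m m (s % m))
  (trans (n*m∸1∸s≡[n∸1∸s/m]*m+[m∸1∸s%m] n m s s<nm) (+-comm _ (m ∸ 1 ∸ s % m)))

[[b^[1+k]*m∸1∸s]/m]%b≡b∸1∸[s/m]%b : ∀ b k m s .{{_ : NonZero b}} .{{_ : NonZero m}} → s < b ^ suc k * m →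
  ((b ^ suc k * m ∸ 1 ∸ s) / m) % b ≡ b ∸ 1 ∸ (s / m) % b
[[b^[1+k]*m∸1∸s]/m]%b≡b∸1∸[s/m]%b b k m s s<b^[1+k]m = begin
  ((b ^ suc k * m ∸ 1 ∸ s) / m) % b ≡⟨ cong (_% b) ([n*m∸1∸s]/m≡n∸1∸s/m (b ^ suc k) m s s<b^[1+k]m) ⟩
  (b ^ suc k ∸ 1 ∸ s / m) % b       ≡⟨ cong (λ t → (t ∸ 1 ∸ s / m) % b) (*-comm b (b ^ k)) ⟩
  (b ^ k * b ∸ 1 ∸ s / m) % b       ≡⟨ [n*m∸1∸s]%m≡m∸1∸s%m (b ^ k) b (s / m) s/m<b^k*b ⟩
  b ∸ 1 ∸ (s / m) % b               ∎
  where
  open ≡-Reasoning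
  s/m<b^k*b : s / m < b ^ k * b
  s/m<b^k*b = subst (s / m <_) (*-comm b (b ^ k)) (m<n*o⇒m/o<n s<b^[1+k]m)

a≤b⇒[a*q+b]/[1+q]≡a : ∀ q a b → b < q → a ≤ b → (a * q + b) / suc q ≡ a
a≤b⇒[a*q+b]/[1+q]≡a q a b b<q a≤b with m≤n⇒∃[o]m+o≡n a≤b
... | x , refl = x≡r+k*m⇒x/m≡k a (s≤s (≤-trans (m≤n+m x a) (<⇒≤ b<q))) (regroup q a x)
  where
  regroup : ∀ q a x → a * q + (a + x) ≡ x + a * suc q
  regroup = solve-∀

b<a⇒1+[a*q+b]/[1+q]≡a : ∀ q a b → a < q → b < a → suc ((a * q + b) / suc q) ≡ a
b<a⇒1+[a*q+b]/[1+q]≡a q a b a<q b<a with m≤n⇒∃[o]m+o≡n b<a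
... | k , refl with m≤n⇒∃[o]m+o≡n (≤-trans (s≤s (m≤n+m k b)) (<⇒≤ a<q))
...   | m , refl = cong suc (x≡r+k*m⇒x/m≡k (b + k) (s≤s (s≤s (m≤n+m m k))) (regroup b k m))
  where
  regroup : ∀ b k m → suc (b + k) * (suc k + m) + b ≡ suc m + (b + k) * suc (suc k + m)
  regroup = solve-∀

s≤m⇒[1+s]*m≡[m∸s]+s*[1+m] : ∀ s m → s ≤ m → suc s * m ≡ (m ∸ s) + s * suc m
s≤m⇒[1+s]*m≡[m∸s]+s*[1+m] s m s≤m with m≤n⇒∃[o]m+o≡n s≤m
... | j , refl = trans (regroup s j) (cong (λ x → x + s * suc (s + j)) (sym (m+n∸m≡n s j)))
  where
  regroup : ∀ s j → suc s * (s + j) ≡ j + s * suc (s + j)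
  regroup = solve-∀

a<b⇒[m*[a*[1+m]+b]]%M≡[b∸a]*m : ∀ m M .{{_ : NonZero m}} .{{_ : NonZero M}} → M ≡ m * suc (suc m) →
  ∀ a b → a < b → b < suc m → (m * (a * suc m + b)) % M ≡ (b ∸ a) * m
a<b⇒[m*[a*[1+m]+b]]%M≡[b∸a]*m m M M≡ a b a<b b<1+m with m≤n⇒∃[o]m+o≡n (<⇒≤ a<b)
... | x , refl = x≡r+k*m⇒x%m≡r a rest<M (trans (regroup m a x) (cong₂ (λ u t → u * m + a * t) (sym (m+n∸m≡n a x)) (sym M≡)))
  where
  regroup : ∀ m a x → m * (a * suc m + (a + x)) ≡ x * m + a * (m * suc (suc m))
  regroup = solve-∀
  rest<M : (a + x ∸ a) * m < M
  rest<M = subst₂ _<_ (cong (_* m) (sym (m+n∸m≡n a x))) (sym M≡) (begin-strict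
    x * m             ≡⟨ *-comm x m ⟩
    m * x             <⟨ *-monoʳ-< m (≤-trans (s≤s (m≤n+m x a)) (≤-trans b<1+m (n≤1+n (suc m)))) ⟩
    m * suc (suc m)   ∎)
    where open ≤-Reasoning

b<a⇒[m*[a*[1+m]+b]]%M+[a∸b]*m≡M : ∀ m M .{{_ : NonZero M}} → M ≡ m * suc (suc m) →
  ∀ a b → b < a → a < suc m → (m * (a * suc m + b)) % M + (a ∸ b) * m ≡ M
b<a⇒[m*[a*[1+m]+b]]%M+[a∸b]*m≡M m M M≡ a b b<a a<1+m with m≤n⇒∃[o]m+o≡n b<a
... | y , refl with m≤n⇒∃[o]m+o≡n (≤-trans (s≤s (m≤n+m y b)) (≤-pred a<1+m))
...   | z , refl = begin
  (m′ * (a′ * suc m′ + b)) % M + (a′ ∸ b) * m′ ≡⟨ cong₂ (λ u t → u + t * m′) (x≡r+k*m⇒x%m≡r (b + y) rest<M eq) a′∸b≡ ⟩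
  m′ * (z + 2) + suc y * m′                    ≡⟨ regroup′ y z ⟩
  m′ * suc (suc m′)                            ≡⟨ sym M≡ ⟩
  M                                            ∎
  where
  open ≡-Reasoning
  m′ = suc y + z
  a′ = suc (b + y)
  regroup : ∀ b y z → (suc y + z) * (suc (b + y) * suc (suc y + z) + b)
                      ≡ (suc y + z) * (z + 2) + (b + y) * ((suc y + z) * suc (suc (suc y + z)))
  regroup = solve-∀
  regroup′ : ∀ y z → (suc y + z) * (z + 2) + suc y * (suc y + z) ≡ (suc y + z) * suc (suc (suc y + z))
  regroup′ = solve-∀
  eq : m′ * (a′ * suc m′ + b) ≡ m′ * (z + 2) + (b + y) * M
  eq = trans (regroup b y z) (cong (λ t → m′ * (z + 2) + (b + y) * t) (sym M≡))
  a′∸b≡ : a′ ∸ b ≡ suc y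
  a′∸b≡ = trans (cong (_∸ b) (sym (+-suc b y))) (m+n∸m≡n b (suc y))
  rest<M : m′ * (z + 2) < M
  rest<M = subst (m′ * (z + 2) <_) (sym M≡)
             (*-monoʳ-< m′ (s≤s (≤-trans (≤-reflexive (+-comm z 2)) (s≤s (s≤s (m≤n+m z y))))))

≡0⊎≡1⊎≥2 : ∀ n → n ≡ 0 ⊎ n ≡ 1 ⊎ 2 ≤ n
≡0⊎≡1⊎≥2 zero          = inj₁ refl
≡0⊎≡1⊎≥2 (suc zero)    = inj₂ (inj₁ refl)
≡0⊎≡1⊎≥2 (suc (suc n)) = inj₂ (inj₂ (s≤s (s≤s z≤n)))

isO : Sym → Bool
isO O = true
isO _ = false

≡O⇒isO≡true : ∀ {s} → s ≡ O → isO s ≡ true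
≡O⇒isO≡true refl = refl

≢O⇒isO≡false : ∀ {s} → s ≢ O → isO s ≡ false
≢O⇒isO≡false {A}  _ = refl
≢O⇒isO≡false {B}  _ = refl
≢O⇒isO≡false {AB} _ = refl
≢O⇒isO≡false {O}  s≢O = ⊥-elim (s≢O refl)

-- The symbol dictated by the digit w, given whether the next symbol is 0.
predict : ℕ → Bool → Sym
predict zero          false = A
predict zero          true  = AB
predict (suc zero)    false = B
predict (suc zero)    true  = O
predict (suc (suc _)) _     = O

predict≡A⇒w≡0 : ∀ w o → predict w o ≡ A → w ≡ 0
predict≡A⇒w≡0 zero          _     _ = refl
predict≡A⇒w≡0 (suc zero)    false ()
predict≡A⇒w≡0 (suc zero)    true  ()
predict≡A⇒w≡0 (suc (suc w)) _     ()

predict≡AB⇒w≡0 : ∀ w o → predict w o ≡ AB → w ≡ 0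
predict≡AB⇒w≡0 zero          _     _ = refl
predict≡AB⇒w≡0 (suc zero)    false ()
predict≡AB⇒w≡0 (suc zero)    true  ()
predict≡AB⇒w≡0 (suc (suc w)) _     ()

predict≡B⇒w≡1 : ∀ w o → predict w o ≡ B → w ≡ 1
predict≡B⇒w≡1 zero          false ()
predict≡B⇒w≡1 zero          true  ()
predict≡B⇒w≡1 (suc zero)    _     _ = refl
predict≡B⇒w≡1 (suc (suc w)) _     ()

predict≡O⇒1≤w : ∀ w o → predict w o ≡ O → 1 ≤ w
predict≡O⇒1≤w zero    false ()
predict≡O⇒1≤w zero    true  ()
predict≡O⇒1≤w (suc w) _     _ = s≤s z≤n

predict-false≡O⇒2≤w : ∀ w → predict w false ≡ O → 2 ≤ w
predict-false≡O⇒2≤w zero          ()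
predict-false≡O⇒2≤w (suc zero)    ()
predict-false≡O⇒2≤w (suc (suc w)) _ = s≤s (s≤s z≤n)

1≤w⇒predict-true≡O : ∀ w → 1 ≤ w → predict w true ≡ O
1≤w⇒predict-true≡O (suc zero)    _ = refl
1≤w⇒predict-true≡O (suc (suc w)) _ = refl

2≤w⇒predict≡O : ∀ w o → 2 ≤ w → predict w o ≡ O
2≤w⇒predict≡O (suc zero)    _ (s≤s ())
2≤w⇒predict≡O (suc (suc w)) _ _ = refl

isO∘predict-cong : ∀ w o o′ → (w ≡ 1 → o ≡ o′) → isO (predict w o) ≡ isO (predict w o′)
isO∘predict-cong zero          false false _ = refl
isO∘predict-cong zero          false true  _ = refl
isO∘predict-cong zero          true  false _ = refl
isO∘predict-cong zero          true  true  _ = refl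
isO∘predict-cong (suc zero)    o     o′ o≡o′ = cong (λ o → isO (predict 1 o)) (o≡o′ refl)
isO∘predict-cong (suc (suc w)) _     _  _ = refl

-- DigitConditions p f h γ′ X unfolds to ∀ i → DigitCondition (p ∸ 1) (v p f h γ′ i) (X i) (X (i + 1)).
DigitCondition : ℕ → ℕ → Sym → Sym → Set
DigitCondition m w s s⁺ =
    (s ≡ A  → w ≡ 0)
  × (s ≡ AB → w ≡ 0)
  × (s ≡ B  → w ≡ 1)
  × (s ≡ O → s⁺ ≡ O → (1 ≤ w × w ≤ m))
  × (s ≡ O → ¬ (s⁺ ≡ O) → (2 ≤ w × w ≤ m))

predict⇒DigitCondition : ∀ {m w s s⁺} → w ≤ m → s ≡ predict w (isO s⁺) → DigitCondition m w s s⁺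
predict⇒DigitCondition {m} {w} {s⁺ = s⁺} w≤m refl =
    predict≡A⇒w≡0 w (isO s⁺)
  , predict≡AB⇒w≡0 w (isO s⁺)
  , predict≡B⇒w≡1 w (isO s⁺)
  , (λ s≡O _ → predict≡O⇒1≤w w (isO s⁺) s≡O , w≤m)
  , (λ s≡O s⁺≢O → predict-false≡O⇒2≤w w (subst (λ o → predict w o ≡ O) (≢O⇒isO≡false s⁺≢O) s≡O) , w≤m)

-- The last two hypotheses are the rules of a gene around 0 and AB.
DigitCondition⇒predict : ∀ {m w} s s⁺ → DigitCondition m w s s⁺ →
  (s⁺ ≡ O → s ≡ AB ⊎ s ≡ O) → (s ≡ AB → s⁺ ≡ O) → s ≡ predict w (isO s⁺)
DigitCondition⇒predict A s⁺ (A→0 , _) before-O _ =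
  sym (cong₂ predict (A→0 refl) (≢O⇒isO≡false λ s⁺≡O → [ (λ ()) , (λ ()) ]′ (before-O s⁺≡O)))
DigitCondition⇒predict AB s⁺ (_ , AB→0 , _) _ after-AB = sym (cong₂ predict (AB→0 refl) (≡O⇒isO≡true (after-AB refl)))
DigitCondition⇒predict B s⁺ (_ , _ , B→1 , _) before-O _ =
  sym (cong₂ predict (B→1 refl) (≢O⇒isO≡false λ s⁺≡O → [ (λ ()) , (λ ()) ]′ (before-O s⁺≡O)))
DigitCondition⇒predict {w = w} O O  (_ , _ , _ , O→O , _) _ _ = sym (1≤w⇒predict-true≡O w (proj₁ (O→O refl refl)))
DigitCondition⇒predict {w = w} O A  (_ , _ , _ , _ , O→¬O) _ _ = sym (2≤w⇒predict≡O w false (proj₁ (O→¬O refl λ ())))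
DigitCondition⇒predict {w = w} O B  (_ , _ , _ , _ , O→¬O) _ _ = sym (2≤w⇒predict≡O w false (proj₁ (O→¬O refl λ ())))
DigitCondition⇒predict {w = w} O AB (_ , _ , _ , _ , O→¬O) _ _ = sym (2≤w⇒predict≡O w false (proj₁ (O→¬O refl λ ())))

module _ (w : ℤ → ℕ) where

  FollowsDigits : (ℤ → Sym) → Set
  FollowsDigits X = ∀ i → X i ≡ predict (w i) (isO (X (i +ᶻ + 1)))

  -- Away from runs of the digit 1 the digit alone decides whether the symbol is 0; along such a run
  -- it is 0 exactly when the next one is.
  FollowsDigits-unique : ∀ n {X Y} → (∀ i → ¬ (∀ t → t < n → w (i +ᶻ + t) ≡ 1)) →
    FollowsDigits X → FollowsDigits Y → ∀ i → X i ≡ Y i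
  FollowsDigits-unique n {X} {Y} no-long-run X-follows Y-follows i =
    trans (X-follows i) (trans (cong (predict (w i)) (isO-agree n (i +ᶻ + 1) (no-long-run (i +ᶻ + 1)))) (sym (Y-follows i)))
    where
    open ≡-Reasoning
    isO-agree : ∀ n i → ¬ (∀ t → t < n → w (i +ᶻ + t) ≡ 1) → isO (X i) ≡ isO (Y i)
    isO-agree zero    i no-run = ⊥-elim (no-run λ _ ())
    isO-agree (suc n) i no-run = begin
      isO (X i)                                   ≡⟨ cong isO (X-follows i) ⟩
      isO (predict (w i) (isO (X (i +ᶻ + 1))))    ≡⟨ isO∘predict-cong (w i) _ _ (λ w≡1 → isO-agree n (i +ᶻ + 1) (λ run → no-run (extend w≡1 run))) ⟩
      isO (predict (w i) (isO (Y (i +ᶻ + 1))))    ≡⟨ cong isO (sym (Y-follows i)) ⟩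
      isO (Y i)                                   ∎
      where
      extend : w i ≡ 1 → (∀ t → t < n → w ((i +ᶻ + 1) +ᶻ + t) ≡ 1) → ∀ t → t < suc n → w (i +ᶻ + t) ≡ 1
      extend w≡1 run zero          _         = trans (cong w (ℤP.+-identityʳ i)) w≡1
      extend w≡1 run (suc t) (s≤s t<n) = trans (cong w (sym ([i+1]+t≡i+[1+t] i t))) (run t t<n)

-- The thresholds of a gene in terms of p = r + 1 ≥ 3, μ = ν/p = 1 + p + ⋯ + p^(f-2), P = p^(f-1) = 1 + rμ
-- and Q = q = pP.
module Thresholds (r₂ n₁ : ℕ) where
  r = suc (suc r₂)
  p = suc r
  μ = suc n₁
  P = suc (r * μ)
  Q = p * P

  Classified : ℕ → ℕ → ℕ → Sym → Set
  Classified α ι₀ ιf A  = α < μ + ιf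
  Classified α ι₀ ιf AB = (μ + ιf ≤ α) × (α ≤ r * μ ∸ ι₀)
  Classified α ι₀ ιf B  = (r * μ ∸ ι₀ < α) × (α ≤ p * μ)
  Classified α ι₀ ιf O  = p * μ < α

  -- pμ = ν, so p * μ < α⁺ says that the next symbol is 0.
  NextDecides : ℕ → ℕ → ℕ → ℕ → Sym → Sym → Set
  NextDecides α ι₀ ιf α⁺ s t = (α⁺ ≤ p * μ → Classified α ι₀ ιf s) × (p * μ < α⁺ → Classified α ι₀ ιf t)

  -- How α and ι at a position are read off the two base-Q digits a, b of the rotated N.
  IsAlpha : ℕ → ℕ → ℕ → Set
  IsAlpha a b α = (b < a → suc α ≡ a) × (a ≤ b → α ≡ a)

  IsIota : ℕ → ℕ → ℕ → Set
  IsIota a b ι = (a < b → (r * P < b ∸ a → ι ≡ 1) × (b ∸ a ≤ r * P → ι ≡ 0))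
               × (b < a → (a ∸ b ≤ P → ι ≡ 1) × (P < a ∸ b → ι ≡ 0))

  Bit : ℕ → Set
  Bit ι = ι ≡ 0 ⊎ ι ≡ 1

  Bit⇒≤1 : ∀ {ι} → Bit ι → ι ≤ 1
  Bit⇒≤1 (inj₁ refl) = z≤n
  Bit⇒≤1 (inj₂ refl) = s≤s z≤n

  IsAlpha⇒α≤a : ∀ {a b α} → IsAlpha a b α → α ≤ a
  IsAlpha⇒α≤a {a} {b} (b<a⇒ , a≤b⇒) with <-cmp b a
  ... | tri< b<a _ _  = subst (_ ≤_) (b<a⇒ b<a) (n≤1+n _)
  ... | tri≈ _ refl _ = ≤-reflexive (a≤b⇒ ≤-refl)
  ... | tri> _ _ a<b  = ≤-reflexive (a≤b⇒ (<⇒≤ a<b))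

  IsAlpha⇒a≤1+α : ∀ {a b α} → IsAlpha a b α → a ≤ suc α
  IsAlpha⇒a≤1+α {a} {b} (b<a⇒ , a≤b⇒) with <-cmp b a
  ... | tri< b<a _ _  = ≤-reflexive (sym (b<a⇒ b<a))
  ... | tri≈ _ refl _ = subst (λ t → a ≤ suc t) (sym (a≤b⇒ ≤-refl)) (n≤1+n a)
  ... | tri> _ _ a<b  = subst (λ t → a ≤ suc t) (sym (a≤b⇒ (<⇒≤ a<b))) (n≤1+n a)

  μ≤rμ : μ ≤ r * μ
  μ≤rμ = m≤m+n μ (suc r₂ * μ)

  P≤rP : P ≤ r * P
  P≤rP = m≤m+n P (suc r₂ * P)

  μp≡pμ : μ * p ≡ p * μ
  μp≡pμ = *-comm μ p

  1+x≤y⇒x≤y∸1 : ∀ {x y} → suc x ≤ y → x ≤ y ∸ 1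
  1+x≤y⇒x≤y∸1 {x} {y} le = m+n≤o⇒m≤o∸n x (subst (_≤ y) (+-comm 1 x) le)

  rμ<α⇒rμ∸ι<α : ∀ {α} ι → r * μ < α → r * μ ∸ ι < α
  rμ<α⇒rμ∸ι<α ι rμ<α = ≤-<-trans (m∸n≤m _ ι) rμ<α

  a<μ⇒α⁺≤pμ : ∀ {a c b⁺ α⁺} → a < μ → c < p → IsAlpha (a * p + c) b⁺ α⁺ → α⁺ ≤ p * μ
  a<μ⇒α⁺≤pμ {a} {c} {α⁺ = α⁺} a<μ c<p α⁺-spec = begin
    α⁺        ≤⟨ IsAlpha⇒α≤a α⁺-spec ⟩
    a * p + c ≤⟨ +-monoʳ-≤ (a * p) (≤-pred c<p) ⟩
    a * p + r ≤⟨ +-monoʳ-≤ (a * p) (n≤1+n r) ⟩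
    a * p + p ≡⟨ +-comm (a * p) p ⟩
    suc a * p ≤⟨ *-monoˡ-≤ p a<μ ⟩
    μ * p     ≡⟨ μp≡pμ ⟩
    p * μ     ∎
    where open ≤-Reasoning

  μ<a⇒2+pμ≤a*p : ∀ {a} → μ < a → 2 + p * μ ≤ a * p
  μ<a⇒2+pμ≤a*p μ<a = ≤-trans (s≤s (s≤s (≤-trans (≤-reflexive (*-comm p μ)) (m≤n+m (μ * p) (suc r₂)))))
                              (*-monoˡ-≤ p μ<a)

  μ<a⇒pμ<α⁺ : ∀ {a c b⁺ α⁺} → μ < a → IsAlpha (a * p + c) b⁺ α⁺ → p * μ < α⁺
  μ<a⇒pμ<α⁺ {a} {c} μ<a α⁺-spec =
    ≤-pred (≤-trans (μ<a⇒2+pμ≤a*p μ<a) (≤-trans (m≤m+n (a * p) c) (IsAlpha⇒a≤1+α α⁺-spec)))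

  c*P+b<P⇒c≡0 : ∀ c b → c * P + b < P → c ≡ 0
  c*P+b<P⇒c≡0 zero    b _  = refl
  c*P+b<P⇒c≡0 (suc c) b lt = ⊥-elim (<⇒≱ lt (≤-trans (m≤m+n P (c * P)) (m≤m+n _ b)))

  2≤c⇒μ+P<c*P+b : ∀ c b → 2 ≤ c → μ + P < c * P + b
  2≤c⇒μ+P<c*P+b (suc zero) b (s≤s ())
  2≤c⇒μ+P<c*P+b (suc (suc c)) b _ = begin-strict
    μ + P               ≡⟨ +-comm μ P ⟩
    P + μ               <⟨ +-monoʳ-< P (s≤s μ≤rμ) ⟩
    P + P               ≤⟨ +-monoʳ-≤ P (m≤m+n P (c * P)) ⟩
    P + (P + c * P)     ≤⟨ m≤m+n _ b ⟩
    suc (suc c) * P + b ∎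
    where open ≤-Reasoning

  a<b⇒a≤rμ∸ι : ∀ {a b ι} → a < b → b < Q → IsIota a b ι → Bit ι → a < P → a ≤ r * μ ∸ ι
  a<b⇒a≤rμ∸ι a<b b<Q ι-spec (inj₁ refl) (s≤s a≤rμ) = a≤rμ
  a<b⇒a≤rμ∸ι {a} {b} a<b b<Q ι-spec (inj₂ refl) a<P with r * P <? b ∸ a
  ... | no rP≮b∸a = contradiction (proj₂ (proj₁ ι-spec a<b) (≮⇒≥ rP≮b∸a)) λ ()
  ... | yes rP<b∸a = m+n≤o⇒m≤o∸n a (≤-pred (+-cancelʳ-≤ (r * P) (suc (a + 1)) P (begin
    suc (a + 1) + r * P   ≡⟨ cong suc (+-assoc a 1 (r * P)) ⟩
    suc (a + suc (r * P)) ≤⟨ s≤s (+-monoʳ-≤ a rP<b∸a) ⟩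
    suc (a + (b ∸ a))     ≡⟨ cong suc (m+[n∸m]≡n (<⇒≤ a<b)) ⟩
    suc b                 ≤⟨ b<Q ⟩
    Q                     ∎)))
    where open ≤-Reasoning

  1+α<P⇒α≤rμ∸ι : ∀ {α ι} → suc α < P → Bit ι → α ≤ r * μ ∸ ι
  1+α<P⇒α≤rμ∸ι (s≤s le) (inj₁ refl) = ≤-trans (n≤1+n _) le
  1+α<P⇒α≤rμ∸ι (s≤s le) (inj₂ refl) = 1+x≤y⇒x≤y∸1 le

  b≤μ+P⇒α⁺≤pμ : ∀ {c b d α⁺} → c * P + b + d ≤ μ + P → IsAlpha (μ * p + c) (b * p + d) α⁺ → α⁺ ≤ p * μ
  b≤μ+P⇒α⁺≤pμ {zero} le α⁺-spec = ≤-trans (IsAlpha⇒α≤a α⁺-spec) (≤-reflexive (trans (+-identityʳ _) μp≡pμ))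
  b≤μ+P⇒α⁺≤pμ {suc zero} {b} {d} {α⁺} le α⁺-spec =
    ≤-reflexive (suc-injective (trans (proj₁ α⁺-spec b*p+d<μ*p+1) (trans (+-comm (μ * p) 1) (cong suc μp≡pμ))))
    where
    open ≤-Reasoning
    b+d≤μ : b + d ≤ μ
    b+d≤μ = +-cancelˡ-≤ P (b + d) μ (begin
      P + (b + d)    ≡⟨ sym (+-assoc P b d) ⟩
      P + b + d      ≡⟨ cong (λ t → t + b + d) (sym (+-identityʳ P)) ⟩
      P + 0 + b + d  ≤⟨ le ⟩
      μ + P          ≡⟨ +-comm μ P ⟩
      P + μ          ∎)
    b*p+d<μ*p+1 : b * p + d < μ * p + 1
    b*p+d<μ*p+1 = begin-strict
      b * p + d      ≤⟨ +-monoʳ-≤ (b * p) (m≤m*n d p) ⟩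
      b * p + d * p  ≡⟨ sym (*-distribʳ-+ p b d) ⟩
      (b + d) * p    ≤⟨ *-monoˡ-≤ p b+d≤μ ⟩
      μ * p          <⟨ m<m+n (μ * p) (s≤s z≤n) ⟩
      μ * p + 1      ∎
  b≤μ+P⇒α⁺≤pμ {suc (suc c)} {b} {d} le _ =
    ⊥-elim (<⇒≱ (2≤c⇒μ+P<c*P+b (suc (suc c)) b (s≤s (s≤s z≤n))) (≤-trans (m≤m+n _ d) le))

  μ+P<b⇒pμ<α⁺ : ∀ {c b d α⁺} → b < P → μ + P < c * P + b → IsAlpha (μ * p + c) (b * p + d) α⁺ → p * μ < α⁺
  μ+P<b⇒pμ<α⁺ {zero} b<P lt _ = ⊥-elim (<⇒≱ lt (≤-trans (<⇒≤ b<P) (m≤n+m P μ)))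
  μ+P<b⇒pμ<α⁺ {suc zero} {b} {d} b<P lt α⁺-spec =
    subst (p * μ <_) (sym (proj₂ α⁺-spec μ*p+1≤b*p+d)) (≤-reflexive (trans (cong suc (sym μp≡pμ)) (+-comm 1 (μ * p))))
    where
    open ≤-Reasoning
    μ<b : μ < b
    μ<b = +-cancelˡ-< P μ b (begin-strict
      P + μ      ≡⟨ +-comm P μ ⟩
      μ + P      <⟨ lt ⟩
      P + 0 + b  ≡⟨ cong (_+ b) (+-identityʳ P) ⟩
      P + b      ∎)
    μ*p+1≤b*p+d : μ * p + 1 ≤ b * p + d
    μ*p+1≤b*p+d = begin
      μ * p + 1         ≡⟨ trans (+-comm (μ * p) 1) (cong suc μp≡pμ) ⟩
      suc (p * μ)       ≤⟨ n≤1+n _ ⟩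
      suc (suc (p * μ)) ≤⟨ μ<a⇒2+pμ≤a*p μ<b ⟩
      b * p             ≤⟨ m≤m+n _ d ⟩
      b * p + d         ∎
  μ+P<b⇒pμ<α⁺ {suc (suc c)} _ _ α⁺-spec = ≤-pred (begin
    suc (suc (p * μ))   ≡⟨ cong (λ t → suc (suc t)) (sym μp≡pμ) ⟩
    suc (suc (μ * p))   ≡⟨ cong suc (+-comm 1 (μ * p)) ⟩
    suc (μ * p + 1)     ≤⟨ s≤s (+-monoʳ-≤ (μ * p) (s≤s z≤n)) ⟩
    suc (μ * p + suc c) ≡⟨ sym (+-suc (μ * p) (suc c)) ⟩
    μ * p + suc (suc c) ≤⟨ IsAlpha⇒a≤1+α α⁺-spec ⟩
    suc _               ∎)
    where open ≤-Reasoning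

  classify-lead0-b<a : ∀ {a b c b′ α ι₀ ιf α⁺} → a < P → b < a → b ≡ c * P + b′ →
    IsAlpha a b α → IsIota b a ιf → Bit ι₀ → IsAlpha (a * p + c) (b′ * p) α⁺ → NextDecides α ι₀ ιf α⁺ A AB
  classify-lead0-b<a {a} {b} {c} {b′} {α} {ι₀} {ιf} {α⁺} a<P b<a refl α-spec ιf-spec bit₀ α⁺-spec = by-cases (a ≤? μ)
    where
    open ≤-Reasoning
    1+α≡a : suc α ≡ a
    1+α≡a = proj₁ α-spec b<a
    1+α⁺≡a*p+c : suc α⁺ ≡ a * p + c
    1+α⁺≡a*p+c = proj₁ α⁺-spec (≤-trans (*-monoˡ-< p (≤-<-trans (m≤n+m b′ (c * P)) b<a)) (m≤m+n (a * p) c))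
    ιf≡0 : ιf ≡ 0
    ιf≡0 = proj₂ (proj₁ ιf-spec b<a) (≤-trans (m∸n≤m a b) (≤-trans (<⇒≤ a<P) P≤rP))
    by-cases : Dec (a ≤ μ) → NextDecides α ι₀ ιf α⁺ A AB
    by-cases (yes a≤μ) = (λ _ → ≤-trans (≤-reflexive 1+α≡a) (≤-trans a≤μ (m≤m+n μ ιf)))
                       , (λ pμ<α⁺ → ⊥-elim (<⇒≱ pμ<α⁺ (≤-pred (begin
      suc α⁺      ≡⟨ 1+α⁺≡a*p+c ⟩
      a * p + c   ≡⟨ cong (λ t → a * p + t) (c*P+b<P⇒c≡0 c b′ (<-trans b<a a<P)) ⟩
      a * p + 0   ≡⟨ +-identityʳ _ ⟩
      a * p       ≤⟨ *-monoˡ-≤ p a≤μ ⟩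
      μ * p       ≡⟨ μp≡pμ ⟩
      p * μ       ≤⟨ n≤1+n _ ⟩
      suc (p * μ) ∎))))
    by-cases (no a≰μ) = (λ α⁺≤pμ → ⊥-elim (<⇒≱ (μ<a⇒pμ<α⁺ (≰⇒> a≰μ) α⁺-spec) α⁺≤pμ))
                      , (λ _ → μ+ιf≤α , 1+α<P⇒α≤rμ∸ι (subst (_< P) (sym 1+α≡a) a<P) bit₀)
      where
      μ+ιf≤α : μ + ιf ≤ α
      μ+ιf≤α = begin
        μ + ιf ≡⟨ cong (λ t → μ + t) ιf≡0 ⟩
        μ + 0  ≡⟨ +-identityʳ μ ⟩
        μ      ≤⟨ ≤-pred (subst (μ <_) (sym 1+α≡a) (≰⇒> a≰μ)) ⟩
        α      ∎

  classify-lead0-a<b : ∀ {a b c b′ α ι₀ ιf α⁺} → a < P → a < b → b ≡ c * P + b′ → b′ < P → c < p → b < Q →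
    IsAlpha a b α → IsIota a b ι₀ → IsIota b a ιf → Bit ι₀ → Bit ιf → IsAlpha (a * p + c) (b′ * p) α⁺ →
    NextDecides α ι₀ ιf α⁺ A AB
  classify-lead0-a<b {a} {b} {c} {b′} {α} {ι₀} {ιf} {α⁺} a<P a<b refl b′<P c<p b<Q α-spec ι₀-spec ιf-spec bit₀ bitf α⁺-spec
    with proj₂ α-spec (<⇒≤ a<b) | <-cmp a μ
  ... | refl | tri< a<μ _ _ =
    (λ _ → ≤-trans a<μ (m≤m+n μ ιf)) , (λ pμ<α⁺ → ⊥-elim (<⇒≱ pμ<α⁺ (a<μ⇒α⁺≤pμ a<μ c<p α⁺-spec)))
  ... | refl | tri> _ _ μ<a =
    (λ α⁺≤pμ → ⊥-elim (<⇒≱ (μ<a⇒pμ<α⁺ μ<a α⁺-spec) α⁺≤pμ))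
    , (λ _ → ≤-trans (+-monoʳ-≤ μ (Bit⇒≤1 bitf)) (subst (_≤ a) (+-comm 1 μ) μ<a) , a<b⇒a≤rμ∸ι a<b b<Q ι₀-spec bit₀ a<P)
  ... | refl | tri≈ _ refl _ with c * P + b′ ∸ μ ≤? P
  ...   | yes b∸μ≤P =
    (λ _ → subst (λ t → μ < μ + t) (sym (proj₁ (proj₂ ιf-spec a<b) b∸μ≤P)) (m<m+n μ (s≤s z≤n)))
    , (λ pμ<α⁺ → ⊥-elim (<⇒≱ pμ<α⁺ (b≤μ+P⇒α⁺≤pμ {d = 0} b≤μ+P (subst (λ t → IsAlpha (μ * p + c) t α⁺) (sym (+-identityʳ _)) α⁺-spec))))
    where
    b≤μ+P : c * P + b′ + 0 ≤ μ + P
    b≤μ+P = ≤-trans (≤-reflexive (+-identityʳ _)) (≤-trans (m≤n+m∸n (c * P + b′) μ) (+-monoʳ-≤ μ b∸μ≤P))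
  ...   | no b∸μ≰P =
    (λ α⁺≤pμ → ⊥-elim (<⇒≱ (μ+P<b⇒pμ<α⁺ {d = 0} b′<P μ+P<b (subst (λ t → IsAlpha (μ * p + c) t α⁺) (sym (+-identityʳ _)) α⁺-spec)) α⁺≤pμ))
    , (λ _ → subst (λ t → μ + t ≤ μ) (sym (proj₂ (proj₂ ιf-spec a<b) (≰⇒> b∸μ≰P))) (≤-reflexive (+-identityʳ μ))
             , a<b⇒a≤rμ∸ι a<b b<Q ι₀-spec bit₀ a<P)
    where
    μ+P<b : μ + P < c * P + b′
    μ+P<b = subst (μ + P <_) (m+[n∸m]≡n (<⇒≤ a<b)) (+-monoʳ-< μ (≰⇒> b∸μ≰P))

  classify-lead0 : ∀ {a b c b′ α ι₀ ιf α⁺} → a < P → b ≡ c * P + b′ → b′ < P → c < p → b < Q → a ≢ b →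
    IsAlpha a b α → IsIota a b ι₀ → IsIota b a ιf → Bit ι₀ → Bit ιf → IsAlpha (a * p + c) (b′ * p) α⁺ →
    NextDecides α ι₀ ιf α⁺ A AB
  classify-lead0 {a} {b} a<P b≡ b′<P c<p b<Q a≢b α-spec ι₀-spec ιf-spec bit₀ bitf α⁺-spec with <-cmp a b
  ... | tri< a<b _ _  = classify-lead0-a<b a<P a<b b≡ b′<P c<p b<Q α-spec ι₀-spec ιf-spec bit₀ bitf α⁺-spec
  ... | tri≈ _ a≡b _  = ⊥-elim (a≢b a≡b)
  ... | tri> _ _ b<a  = classify-lead0-b<a a<P b<a b≡ α-spec ιf-spec bit₀ α⁺-spec

  a′<μ⇒Classified-B : ∀ {a′ b α ι₀ ιf} → a′ < μ → P + a′ ≢ b →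
    IsAlpha (P + a′) b α → IsIota (P + a′) b ι₀ → Classified α ι₀ ιf B
  a′<μ⇒Classified-B {a′} {b} {α} {ι₀} a′<μ a≢b α-spec ι₀-spec = lower , upper
    where
    open ≤-Reasoning
    upper : α ≤ p * μ
    upper = begin
      α                ≤⟨ IsAlpha⇒α≤a α-spec ⟩
      suc (r * μ + a′) ≡⟨ sym (+-suc (r * μ) a′) ⟩
      r * μ + suc a′   ≤⟨ +-monoʳ-≤ (r * μ) a′<μ ⟩
      r * μ + μ        ≡⟨ +-comm (r * μ) μ ⟩
      p * μ            ∎
    lower : r * μ ∸ ι₀ < α
    lower with <-cmp b (P + a′) | a′ ≟ 0
    ... | tri< b<a _ _ | yes refl =
      subst (λ t → r * μ ∸ t < α) (sym ι₀≡1) (≤-reflexive (sym (trans α≡rμ+0 (+-identityʳ _))))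
      where
      α≡rμ+0 : α ≡ r * μ + 0
      α≡rμ+0 = suc-injective (proj₁ α-spec b<a)
      ι₀≡1 : ι₀ ≡ 1
      ι₀≡1 = proj₁ (proj₂ ι₀-spec b<a) (≤-trans (m∸n≤m (P + 0) b) (≤-reflexive (+-identityʳ P)))
    ... | tri< b<a _ _ | no a′≢0 = rμ<α⇒rμ∸ι<α ι₀
      (subst (r * μ <_) (sym (suc-injective (proj₁ α-spec b<a))) (m<m+n (r * μ) (n≢0⇒n>0 a′≢0)))
    ... | tri≈ _ b≡a _ | _ = ⊥-elim (a≢b (sym b≡a))
    ... | tri> _ _ a<b | _ = rμ<α⇒rμ∸ι<α ι₀
      (subst (r * μ <_) (sym (proj₂ α-spec (<⇒≤ a<b))) (s≤s (m≤m+n (r * μ) a′)))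

  classify-lead1 : ∀ {a′ b c b′ α ι₀ ιf α⁺} → a′ < P → b ≡ c * P + b′ → b′ < P → c < p → P + a′ ≢ b →
    IsAlpha (P + a′) b α → IsIota (P + a′) b ι₀ → IsAlpha (a′ * p + c) (b′ * p + 1) α⁺ →
    NextDecides α ι₀ ιf α⁺ B O
  classify-lead1 {a′} {b} {c} {b′} {α} {ι₀} {ιf} {α⁺} a′<P refl b′<P c<p a≢b α-spec ι₀-spec α⁺-spec with <-cmp a′ μ
  ... | tri< a′<μ _ _ =
    (λ _ → a′<μ⇒Classified-B {ιf = ιf} a′<μ a≢b α-spec ι₀-spec) , (λ pμ<α⁺ → ⊥-elim (<⇒≱ pμ<α⁺ (a<μ⇒α⁺≤pμ a′<μ c<p α⁺-spec)))
  ... | tri> _ _ μ<a′ = (λ α⁺≤pμ → ⊥-elim (<⇒≱ (μ<a⇒pμ<α⁺ μ<a′ α⁺-spec) α⁺≤pμ)) , (λ _ → begin-strict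
    p * μ      ≡⟨ +-comm μ (r * μ) ⟩
    r * μ + μ  <⟨ +-monoʳ-< (r * μ) μ<a′ ⟩
    r * μ + a′ ≤⟨ ≤-pred (IsAlpha⇒a≤1+α α-spec) ⟩
    α          ∎)
    where open ≤-Reasoning
  ... | tri≈ _ refl _ with <-cmp b (P + μ)
  ...   | tri≈ _ b≡a _ = ⊥-elim (a≢b (sym b≡a))
  ...   | tri< b<a _ _ =
    (λ _ → rμ<α⇒rμ∸ι<α ι₀ (subst (r * μ <_) (sym α≡rμ+μ) (m<m+n (r * μ) (s≤s z≤n))) , ≤-reflexive (trans α≡rμ+μ (+-comm (r * μ) μ)))
    , (λ pμ<α⁺ → ⊥-elim (<⇒≱ pμ<α⁺ (b≤μ+P⇒α⁺≤pμ (≤-trans (≤-reflexive (+-comm _ 1)) (≤-trans b<a (≤-reflexive (+-comm P μ)))) α⁺-spec)))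
    where
    α≡rμ+μ : α ≡ r * μ + μ
    α≡rμ+μ = suc-injective (proj₁ α-spec b<a)
  ...   | tri> _ _ a<b =
    (λ α⁺≤pμ → ⊥-elim (<⇒≱ (μ+P<b⇒pμ<α⁺ b′<P (subst (_< c * P + b′) (+-comm P μ) a<b) α⁺-spec) α⁺≤pμ))
    , (λ _ → subst (p * μ <_) (sym (proj₂ α-spec (<⇒≤ a<b))) (s≤s (≤-reflexive (+-comm μ (r * μ)))))

  classify-lead≥2 : ∀ {a′ d b α ι₀ ιf} → 2 ≤ d → IsAlpha (d * P + a′) b α → Classified α ι₀ ιf O
  classify-lead≥2 {a′} {suc (suc d)} {b} {α} (s≤s (s≤s z≤n)) α-spec = ≤-pred (≤-pred (begin
    3 + p * μ                   ≡⟨ cong (λ t → 3 + t) (+-comm μ (r * μ)) ⟩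
    3 + (r * μ + μ)             ≤⟨ s≤s (s≤s (s≤s (+-monoʳ-≤ (r * μ) μ≤rμ))) ⟩
    3 + (r * μ + r * μ)         ≡⟨ cong suc (sym (+-suc (suc (r * μ)) (r * μ))) ⟩
    suc (P + P)                 ≤⟨ s≤s (+-monoʳ-≤ P (m≤m+n P (d * P))) ⟩
    suc (suc (suc d) * P)       ≤⟨ s≤s (m≤m+n _ a′) ⟩
    suc (suc (suc d) * P + a′)  ≤⟨ s≤s (IsAlpha⇒a≤1+α α-spec) ⟩
    suc (suc α)                 ∎))
    where open ≤-Reasoning

  μ+ιf≤1+rμ∸ι₀ : ∀ {ι₀ ιf} → Bit ι₀ → Bit ιf → μ + ιf ≤ suc (r * μ ∸ ι₀)
  μ+ιf≤1+rμ∸ι₀ (inj₁ refl) (inj₁ refl) = ≤-trans (≤-reflexive (+-identityʳ μ)) (≤-trans μ≤rμ (n≤1+n _))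
  μ+ιf≤1+rμ∸ι₀ (inj₁ refl) (inj₂ refl) = ≤-trans (≤-reflexive (+-comm μ 1)) (s≤s μ≤rμ)
  μ+ιf≤1+rμ∸ι₀ (inj₂ refl) (inj₁ refl) = ≤-trans (≤-reflexive (+-identityʳ μ)) μ≤rμ
  μ+ιf≤1+rμ∸ι₀ (inj₂ refl) (inj₂ refl) =
    ≤-trans (≤-reflexive (+-comm μ 1)) (s≤s (≤-trans (≤-reflexive (+-comm 1 n₁)) (+-monoʳ-≤ n₁ (s≤s z≤n))))

  Classified-unique : ∀ {α ι₀ ιf} → Bit ι₀ → Bit ιf → ∀ s t → Classified α ι₀ ιf s → Classified α ι₀ ιf t → s ≡ t
  Classified-unique {α} {ι₀} {ιf} bit₀ bitf = go
    where
    A|B : μ + ιf ≤ suc (r * μ ∸ ι₀)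
    A|B = μ+ιf≤1+rμ∸ι₀ bit₀ bitf
    rμ∸ι₀≤pμ : r * μ ∸ ι₀ ≤ p * μ
    rμ∸ι₀≤pμ = ≤-trans (m∸n≤m (r * μ) ι₀) (m≤n+m (r * μ) μ)
    A|O : μ + ιf ≤ suc (p * μ)
    A|O = ≤-trans A|B (s≤s rμ∸ι₀≤pμ)
    go : ∀ s t → Classified α ι₀ ιf s → Classified α ι₀ ιf t → s ≡ t
    go A  A  _ _ = refl
    go AB AB _ _ = refl
    go B  B  _ _ = refl
    go O  O  _ _ = refl
    go A  AB x y = ⊥-elim (<⇒≱ x (proj₁ y))
    go AB A  x y = ⊥-elim (<⇒≱ y (proj₁ x))
    go A  B  x y = ⊥-elim (<-irrefl refl (<-≤-trans (proj₁ y) (≤-pred (≤-trans x A|B))))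
    go B  A  x y = ⊥-elim (<-irrefl refl (<-≤-trans (proj₁ x) (≤-pred (≤-trans y A|B))))
    go A  O  x y = ⊥-elim (<-irrefl refl (<-≤-trans y (≤-pred (≤-trans x A|O))))
    go O  A  x y = ⊥-elim (<-irrefl refl (<-≤-trans x (≤-pred (≤-trans y A|O))))
    go AB B  x y = ⊥-elim (<⇒≱ (proj₁ y) (proj₂ x))
    go B  AB x y = ⊥-elim (<⇒≱ (proj₁ x) (proj₂ y))
    go AB O  x y = ⊥-elim (<⇒≱ y (≤-trans (proj₂ x) rμ∸ι₀≤pμ))
    go O  AB x y = ⊥-elim (<⇒≱ x (≤-trans (proj₂ y) rμ∸ι₀≤pμ))
    go B  O  x y = ⊥-elim (<⇒≱ y (proj₂ x))
    go O  B  x y = ⊥-elim (<⇒≱ x (proj₂ y))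

  Classified⇒α≤pμ : ∀ {α ι₀ ιf} → Bit ιf → ∀ s → s ≢ O → Classified α ι₀ ιf s → α ≤ p * μ
  Classified⇒α≤pμ bitf A _ α<μ+ιf =
    ≤-pred (≤-trans α<μ+ιf (≤-trans (+-monoʳ-≤ μ (Bit⇒≤1 bitf)) (≤-trans (≤-reflexive (+-comm μ 1)) (s≤s (m≤m+n μ (r * μ))))))
  Classified⇒α≤pμ {ι₀ = ι₀} _ AB _ (_ , α≤rμ∸ι₀) = ≤-trans α≤rμ∸ι₀ (≤-trans (m∸n≤m _ ι₀) (m≤n+m _ μ))
  Classified⇒α≤pμ _ B _ (_ , α≤pμ) = α≤pμ
  Classified⇒α≤pμ _ O O≢O _ = ⊥-elim (O≢O refl)

module Setting (r₂ f₂ : ℕ) where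
  p = suc (suc (suc r₂))
  f = suc (suc f₂)

  repunit : ℕ → ℕ
  repunit zero    = 0
  repunit (suc k) = repunit k + p ^ k

  geom≡p*repunit : ∀ k → geom p f k ≡ p * repunit k
  geom≡p*repunit zero    = sym (*-zeroʳ p)
  geom≡p*repunit (suc k) = trans (cong (_+ p ^ suc k) (geom≡p*repunit k)) (sym (*-distribˡ-+ p (repunit k) (p ^ k)))

  [p∸1]*repunit+1≡p^ : ∀ k → suc (suc r₂) * repunit k + 1 ≡ p ^ k
  [p∸1]*repunit+1≡p^ zero    = cong (_+ 1) (*-zeroʳ (suc (suc r₂)))
  [p∸1]*repunit+1≡p^ (suc k) = begin
    r * (repunit k + p ^ k) + 1       ≡⟨ regroup r (repunit k) (p ^ k) ⟩
    (r * repunit k + 1) + r * p ^ k   ≡⟨ cong (_+ r * p ^ k) ([p∸1]*repunit+1≡p^ k) ⟩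
    p ^ suc k                         ∎
    where
    open ≡-Reasoning
    r = suc (suc r₂)
    regroup : ∀ a b c → a * (b + c) + 1 ≡ (a * b + 1) + a * c
    regroup = solve-∀

  open Thresholds r₂ (repunit (suc f₂) ∸ 1) public hiding (p)

  μ≡repunit : μ ≡ repunit (suc f₂)
  μ≡repunit = trans (+-comm 1 _) (m∸n+n≡m (≤-trans (m^n>0 p f₂) (m≤n+m (p ^ f₂) (repunit f₂))))

  p^[f∸1]≡P : p ^ (f ∸ 1) ≡ P
  p^[f∸1]≡P = trans (sym ([p∸1]*repunit+1≡p^ (suc f₂))) (trans (cong (λ t → r * t + 1) (sym μ≡repunit)) (+-comm (r * μ) 1))

  q≡Q : q p f ≡ Q
  q≡Q = cong (p *_) p^[f∸1]≡P

  ν≡pμ : ν p f ≡ p * μ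
  ν≡pμ = trans (geom≡p*repunit (suc f₂)) (cong (p *_) (sym μ≡repunit))

  ν/′p≡μ : ν p f /′ p ≡ μ
  ν/′p≡μ = trans (/′≡/ (ν p f) p) (trans (cong (_/ p) (trans ν≡pμ (*-comm p μ))) (m*n/n≡m μ p))

  +[[p∸1]*ν/′p]-+ι≡+[rμ∸ι] : ∀ {ι} → Bit ι → + (((p ∸ 1) * ν p f) /′ p) -ᶻ + ι ≡ + (r * μ ∸ ι)
  +[[p∸1]*ν/′p]-+ι≡+[rμ∸ι] {ι} bit = begin
    + (((p ∸ 1) * ν p f) /′ p) -ᶻ + ι ≡⟨ cong (λ t → + t -ᶻ + ι) [p∸1]*ν/′p≡rμ ⟩
    + (r * μ) -ᶻ + ι                   ≡⟨ ℤP.m-n≡m⊖n (r * μ) ι ⟩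
    (r * μ) ℤ.⊖ ι                      ≡⟨ ℤP.⊖-≥ (≤-trans (Bit⇒≤1 bit) (s≤s z≤n)) ⟩
    + (r * μ ∸ ι)                      ∎
    where
    open ≡-Reasoning
    [p∸1]*ν/′p≡rμ : ((p ∸ 1) * ν p f) /′ p ≡ r * μ
    [p∸1]*ν/′p≡rμ = trans (/′≡/ ((p ∸ 1) * ν p f) p) (trans (cong (_/ p) (trans (cong (r *_) ν≡pμ) (regroup r p μ))) (m*n/n≡m (r * μ) p))
      where
      regroup : ∀ a b c → a * (b * c) ≡ a * c * b
      regroup = solve-∀

  ClassifiedAs⇒Classified : ∀ h γ′ {a ι₀ ιf} → Bit ι₀ → ∀ s → ClassifiedAs p f h γ′ a ι₀ ιf s → Classified a ι₀ ιf s
  ClassifiedAs⇒Classified h γ′ {a} {ιf = ιf} _ A x = subst (λ t → a < t + ιf) ν/′p≡μ x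
  ClassifiedAs⇒Classified h γ′ {a} {ιf = ιf} bit₀ AB (x , y) =
    subst (λ t → t + ιf ≤ a) ν/′p≡μ x , ℤP.drop‿+≤+ (subst (+ a ℤ.≤_) (+[[p∸1]*ν/′p]-+ι≡+[rμ∸ι] bit₀) y)
  ClassifiedAs⇒Classified h γ′ {a} bit₀ B (x , y) =
    ℤP.drop‿+<+ (subst (ℤ._< + a) (+[[p∸1]*ν/′p]-+ι≡+[rμ∸ι] bit₀) x) , subst (a ≤_) ν≡pμ y
  ClassifiedAs⇒Classified h γ′ {a} _ O x = subst (_< a) ν≡pμ x

  Classified⇒ClassifiedAs : ∀ h γ′ {a ι₀ ιf} → Bit ι₀ → ∀ s → Classified a ι₀ ιf s → ClassifiedAs p f h γ′ a ι₀ ιf s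
  Classified⇒ClassifiedAs h γ′ {a} {ιf = ιf} _ A x = subst (λ t → a < t + ιf) (sym ν/′p≡μ) x
  Classified⇒ClassifiedAs h γ′ {a} {ιf = ιf} bit₀ AB (x , y) =
    subst (λ t → t + ιf ≤ a) (sym ν/′p≡μ) x , subst (+ a ℤ.≤_) (sym (+[[p∸1]*ν/′p]-+ι≡+[rμ∸ι] bit₀)) (ℤ.+≤+ y)
  Classified⇒ClassifiedAs h γ′ {a} bit₀ B (x , y) =
    subst (ℤ._< + a) (sym (+[[p∸1]*ν/′p]-+ι≡+[rμ∸ι] bit₀)) (ℤ.+<+ x) , subst (a ≤_) (sym ν≡pμ) y
  Classified⇒ClassifiedAs h γ′ {a} _ O x = subst (_< a) (sym ν≡pμ) x

  Q₀ = Q ∸ 1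
  K = 2 * f
  M = Q * Q ∸ 1

  M≡Q₀*[2+Q₀] : M ≡ Q₀ * suc (suc Q₀)
  M≡Q₀*[2+Q₀] = cong (_∸ 1) (expand Q₀)
    where
    expand : ∀ x → suc x * suc x ≡ suc (x * suc (suc x))
    expand = solve-∀

  instance
    M≢0 : NonZero M
    M≢0 = ℕ.>-nonZero (subst (0 <_) (sym M≡Q₀*[2+Q₀]) (*-mono-≤ {1} {Q₀} (s≤s z≤n) (s≤s z≤n)))

  p^≢0 : ∀ n → NonZero (p ^ n)
  p^≢0 n = m^n≢0 p n

  _/p^_ : ℕ → ℕ → ℕ
  x /p^ n = _/_ x (p ^ n) {{p^≢0 n}}

  p^K≡Q*Q : p ^ K ≡ Q * Q
  p^K≡Q*Q = trans (cong (p ^_) (cong (λ t → f + t) (+-identityʳ f))) (trans (^-distribˡ-+-* p f f) (cong₂ _*_ q≡Q q≡Q))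

  K∸1≡f+[f∸1] : K ∸ 1 ≡ f + (f ∸ 1)
  K∸1≡f+[f∸1] = cong (_∸ 1) (trans (cong (λ t → f + t) (+-identityʳ f)) (+-suc f (suc f₂)))

  p^[K∸1]≡Q*P : p ^ (K ∸ 1) ≡ Q * P
  p^[K∸1]≡Q*P = trans (cong (p ^_) K∸1≡f+[f∸1]) (trans (^-distribˡ-+-* p f (f ∸ 1)) (cong₂ _*_ q≡Q p^[f∸1]≡P))

  rot : ℕ → ℕ → ℕ
  rot x e = (p ^ e * x) % M

  rot-cong : ∀ {x y} → x % M ≡ y % M → ∀ e → rot x e ≡ rot y e
  rot-cong {x} {y} x≡y e = begin
    (p ^ e * x) % M        ≡⟨ [m*n]%o≡[m*[n%o]]%o (p ^ e) x M ⟩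
    (p ^ e * (x % M)) % M  ≡⟨ cong (λ t → (p ^ e * t) % M) x≡y ⟩
    (p ^ e * (y % M)) % M  ≡⟨ sym ([m*n]%o≡[m*[n%o]]%o (p ^ e) y M) ⟩
    (p ^ e * y) % M        ∎
    where open ≡-Reasoning

  rot-+ : ∀ x e t → rot x (e + t) ≡ (p ^ t * rot x e) % M
  rot-+ x e t = trans (cong (_% M) p^[e+t]*x≡) ([m*n]%o≡[m*[n%o]]%o (p ^ t) (p ^ e * x) M)
    where
    p^[e+t]*x≡ : p ^ (e + t) * x ≡ p ^ t * (p ^ e * x)
    p^[e+t]*x≡ = trans (cong (_* x) (trans (^-distribˡ-+-* p e t) (*-comm (p ^ e) (p ^ t)))) (*-assoc (p ^ t) (p ^ e) x)

  rot-+K : ∀ x e → rot x (e + K) ≡ rot x e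
  rot-+K x e = trans (cong (_% M) p^[e+K]*x≡) ([m+kn]%n≡m%n (p ^ e * x) (p ^ e * x) M)
    where
    regroup : ∀ a m x → a * suc m * x ≡ a * x + (a * x) * m
    regroup = solve-∀
    p^[e+K]*x≡ : p ^ (e + K) * x ≡ p ^ e * x + (p ^ e * x) * M
    p^[e+K]*x≡ = trans (cong (_* x) (trans (^-distribˡ-+-* p e K) (cong (p ^ e *_) p^K≡Q*Q))) (regroup (p ^ e) M x)

  rot-+k*K : ∀ x e k → rot x (e + k * K) ≡ rot x e
  rot-+k*K x e zero    = cong (rot x) (+-identityʳ e)
  rot-+k*K x e (suc k) = trans (cong (rot x) (regroup e K k)) (trans (rot-+K x (e + k * K)) (rot-+k*K x e k))
    where
    regroup : ∀ e K k → e + (K + k * K) ≡ (e + k * K) + K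
    regroup = solve-∀

  rot-%K : ∀ x e → rot x (e % K) ≡ rot x e
  rot-%K x e = trans (sym (rot-+k*K x (e % K) (e / K))) (cong (rot x) (sym (m≡m%n+[m/n]*n e K)))

  red<K : ∀ i → red p f i < K
  red<K i = ℤD.n%ℕd<d i K

  red-+ : ∀ i t → red p f (i +ᶻ + t) ≡ (red p f i + t) % K
  red-+ i t = [i+t]%ℕm≡[i%ℕm+t]%m i t K

  -- Multiplication by p permutes the 2f base-p digits of a residue mod q² - 1 cyclically.
  digit≡lead-rot : ∀ x → x < M → ∀ e → e < K → (x /p^ (K ∸ 1 ∸ e)) % p ≡ (rot x e / Q) / P
  digit≡lead-rot x x<M e e<K = begin
    (x /p^ u) % p         ≡⟨ sym ([k*x%m]/[k*u]≡[x/u]%b p (p ^ e) (p ^ u) M {{_}} {{p^≢0 e}} {{p^≢0 u}} {{_}} {{p^e*p^u≢0}} 1+M≡ x x<M) ⟩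
    _/_ (rot x e) (p ^ e * p ^ u) {{p^e*p^u≢0}} ≡⟨ /-congʳ {{p^e*p^u≢0}} p^e*p^u≡Q*P ⟩
    rot x e / (Q * P)     ≡⟨ sym (m/n/o≡m/[n*o] (rot x e) Q P) ⟩
    (rot x e / Q) / P     ∎
    where
    open ≡-Reasoning
    u = K ∸ 1 ∸ e
    p^e*p^u≢0 : NonZero (p ^ e * p ^ u)
    p^e*p^u≢0 = m*n≢0 (p ^ e) (p ^ u) {{p^≢0 e}} {{p^≢0 u}}
    e+1+u≡K : e + suc u ≡ K
    e+1+u≡K = trans (+-suc e u) (cong suc (m+[n∸m]≡n (≤-pred e<K)))
    1+M≡ : suc M ≡ p ^ e * (p * p ^ u)
    1+M≡ = trans (sym p^K≡Q*Q) (trans (cong (p ^_) (sym e+1+u≡K)) (^-distribˡ-+-* p e (suc u)))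
    p^e*p^u≡Q*P : p ^ e * p ^ u ≡ Q * P
    p^e*p^u≡Q*P = trans (sym (^-distribˡ-+-* p e u))
      (trans (cong (p ^_) (trans (sym (+-∸-assoc e (≤-pred e<K))) (m+n∸m≡n e (K ∸ 1)))) p^[K∸1]≡Q*P)

  +M≡+Q₀*+[1+Q] : + M ≡ + Q₀ *ᶻ + suc Q
  +M≡+Q₀*+[1+Q] = trans (cong +_ M≡Q₀*[2+Q₀]) (ℤP.pos-* Q₀ (suc Q))

  x*Q+y≤M : ∀ {x y} → x < Q → y < Q → x * Q + y ≤ M
  x*Q+y≤M {x} {y} x<Q y<Q = ≤-pred (begin-strict
    x * Q + y ≤⟨ +-monoʳ-≤ (x * Q) (≤-pred y<Q) ⟩
    x * Q + Q₀ <⟨ +-monoʳ-< (x * Q) ≤-refl ⟩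
    x * Q + Q ≡⟨ +-comm (x * Q) Q ⟩
    suc x * Q ≤⟨ *-monoˡ-≤ Q x<Q ⟩
    Q * Q     ∎)
    where open ≤-Reasoning

  x<P⇒x*p+y<Q : ∀ {x y} → x < P → y < p → x * p + y < Q
  x<P⇒x*p+y<Q {x} {y} x<P y<p = begin-strict
    x * p + y ≤⟨ +-monoʳ-≤ (x * p) (≤-pred y<p) ⟩
    x * p + r <⟨ +-monoʳ-< (x * p) ≤-refl ⟩
    x * p + p ≡⟨ +-comm (x * p) p ⟩
    suc x * p ≤⟨ *-monoˡ-≤ p x<P ⟩
    P * p     ≡⟨ *-comm P p ⟩
    Q         ∎
    where open ≤-Reasoning

  x<Q⇒x/P<p : ∀ {x} → x < Q → x / P < p
  x<Q⇒x/P<p {x} x<Q = m<n*o⇒m/o<n {x} {p} {P} x<Q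

  M≡Q*rP+rμ+P*Q₀ : M ≡ Q * (r * P) + r * μ + P * Q₀
  M≡Q*rP+rμ+P*Q₀ = trans M≡Q₀*[2+Q₀] (expand (r * μ) (r * P))
    where
    expand : ∀ x y → (x + y) * suc (suc (x + y)) ≡ suc (x + y) * y + x + suc x * (x + y)
    expand = solve-∀

  r*[Q*P]≡Q*[r*P] : r * (Q * P) ≡ Q * (r * P)
  r*[Q*P]≡Q*[r*P] = x*[y*z]≡y*[x*z] r Q P
    where
    x*[y*z]≡y*[x*z] : ∀ x y z → x * (y * z) ≡ y * (x * z)
    x*[y*z]≡y*[x*z] = solve-∀

  r*QP≤x⇒x/QP≡r : ∀ x → x < M → r * (Q * P) ≤ x → x / (Q * P) ≡ r
  r*QP≤x⇒x/QP≡r x x<M rQP≤x = ≤-antisym (≤-pred (m<n*o⇒m/o<n (subst (x <_) Q*Q≡p*[Q*P] (<-trans x<M ≤-refl))))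
    (subst (_≤ x / (Q * P)) (m*n/n≡m r (Q * P)) (/-monoˡ-≤ (Q * P) rQP≤x))
    where
    Q*Q≡p*[Q*P] : Q * Q ≡ p * (Q * P)
    Q*Q≡p*[Q*P] = regroup p P
      where
      regroup : ∀ p P → (p * P) * (p * P) ≡ p * ((p * P) * P)
      regroup = solve-∀

  x<r*QP⇒x/QP≢r : ∀ x → x < r * (Q * P) → x / (Q * P) ≢ r
  x<r*QP⇒x/QP≢r x x<rQP x/QP≡r = <-irrefl x/QP≡r (m<n*o⇒m/o<n x<rQP)

  rP<d⇒r*QP≤d*Q₀ : ∀ {d} → r * P < d → r * (Q * P) ≤ d * Q₀
  rP<d⇒r*QP≤d*Q₀ {d} rP<d = begin
    r * (Q * P)        ≡⟨ r*[Q*P]≡Q*[r*P] ⟩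
    Q * (r * P)        ≡⟨ *-comm Q (r * P) ⟩
    r * P * Q          ≤⟨ m≤m+n (r * P * Q) (r * μ) ⟩
    r * P * Q + r * μ  ≡⟨ sym (expand (r * μ) (r * P)) ⟩
    suc (r * P) * Q₀   ≤⟨ *-monoˡ-≤ Q₀ rP<d ⟩
    d * Q₀             ∎
    where
    open ≤-Reasoning
    expand : ∀ x y → suc y * (x + y) ≡ y * suc (x + y) + x
    expand = solve-∀

  d≤rP⇒d*Q₀<r*QP : ∀ {d} → d ≤ r * P → d * Q₀ < r * (Q * P)
  d≤rP⇒d*Q₀<r*QP {d} d≤rP = begin-strict
    d * Q₀        ≤⟨ *-monoˡ-≤ Q₀ d≤rP ⟩
    r * P * Q₀    <⟨ *-monoʳ-< (r * P) {Q₀} {Q} ≤-refl ⟩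
    r * P * Q     ≡⟨ *-comm (r * P) Q ⟩
    Q * (r * P)   ≡⟨ sym r*[Q*P]≡Q*[r*P] ⟩
    r * (Q * P)   ∎
    where open ≤-Reasoning

  x+d*Q₀≡M⇒d≤P⇒r*QP≤x : ∀ {x d} → x + d * Q₀ ≡ M → d ≤ P → r * (Q * P) ≤ x
  x+d*Q₀≡M⇒d≤P⇒r*QP≤x {x} {d} x+dQ₀≡M d≤P = +-cancelʳ-≤ (d * Q₀) (r * (Q * P)) x (begin
    r * (Q * P) + d * Q₀          ≡⟨ cong (_+ d * Q₀) r*[Q*P]≡Q*[r*P] ⟩
    Q * (r * P) + d * Q₀          ≤⟨ +-monoʳ-≤ (Q * (r * P)) (*-monoˡ-≤ Q₀ d≤P) ⟩
    Q * (r * P) + P * Q₀          ≤⟨ +-monoˡ-≤ (P * Q₀) (m≤m+n (Q * (r * P)) (r * μ)) ⟩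
    Q * (r * P) + r * μ + P * Q₀  ≡⟨ sym M≡Q*rP+rμ+P*Q₀ ⟩
    M                             ≡⟨ sym x+dQ₀≡M ⟩
    x + d * Q₀                    ∎)
    where open ≤-Reasoning

  x+d*Q₀≡M⇒P<d⇒x<r*QP : ∀ {x d} → x + d * Q₀ ≡ M → P < d → x < r * (Q * P)
  x+d*Q₀≡M⇒P<d⇒x<r*QP {x} {d} x+dQ₀≡M P<d =
    subst (x <_) (sym r*[Q*P]≡Q*[r*P]) (+-cancelʳ-< (r * μ + P * Q₀) x (Q * (r * P)) (begin-strict
      x + (r * μ + P * Q₀)           <⟨ +-monoʳ-< x (+-monoˡ-< (P * Q₀) (m<m+n (r * μ) (s≤s z≤n))) ⟩
      x + suc P * Q₀                 ≤⟨ +-monoʳ-≤ x (*-monoˡ-≤ Q₀ P<d) ⟩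
      x + d * Q₀                     ≡⟨ x+dQ₀≡M ⟩
      M                              ≡⟨ M≡Q*rP+rμ+P*Q₀ ⟩
      Q * (r * P) + r * μ + P * Q₀   ≡⟨ +-assoc (Q * (r * P)) (r * μ) (P * Q₀) ⟩
      Q * (r * P) + (r * μ + P * Q₀) ∎))
    where open ≤-Reasoning

  x/P≡1⇒x≡P+x%P : ∀ {x} → x / P ≡ 1 → x ≡ P + x % P
  x/P≡1⇒x≡P+x%P {x} x/P≡1 = begin
    x                 ≡⟨ m≡m%n+[m/n]*n x P ⟩
    x % P + x / P * P ≡⟨ cong (λ t → x % P + t * P) x/P≡1 ⟩
    x % P + 1 * P     ≡⟨ cong (λ t → x % P + t) (*-identityˡ P) ⟩
    x % P + P         ≡⟨ +-comm (x % P) P ⟩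
    P + x % P         ∎
    where open ≡-Reasoning

  module Triple (h γ′ : ℕ) (q+1∤h : ¬ (q p f + 1 ∣ h)) where

    Q+1∤ᶻh : ∀ (w : ℤ) → + h ≢ + suc Q *ᶻ w
    Q+1∤ᶻh w eq = q+1∤h (divides ℤ.∣ w ∣ (begin
      h                     ≡⟨ cong ℤ.∣_∣ eq ⟩
      ℤ.∣ + suc Q *ᶻ w ∣    ≡⟨ ℤP.∣i*j∣≡∣i∣*∣j∣ (+ suc Q) w ⟩
      suc Q * ℤ.∣ w ∣       ≡⟨ *-comm (suc Q) ℤ.∣ w ∣ ⟩
      ℤ.∣ w ∣ * suc Q       ≡⟨ cong (λ t → ℤ.∣ w ∣ * suc t) (sym q≡Q) ⟩
      ℤ.∣ w ∣ * suc (q p f) ≡⟨ cong (ℤ.∣ w ∣ *_) (+-comm 1 (q p f)) ⟩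
      ℤ.∣ w ∣ * (q p f + 1) ∎))
      where open ≡-Reasoning

    xₙ xₛ : ℤ
    xₙ = + h -ᶻ + suc Q *ᶻ + γ′
    xₛ = + h -ᶻ + 1

    Nₕ : ℕ
    Nₕ = N p f h γ′

    Sₕ : ℕ
    Sₕ = S p f h γ′

    Nₕ≡ : Nₕ ≡ (+ h -ᶻ + suc Q *ᶻ + γ′) ℤ.%ℕ M
    Nₕ≡ = trans (cong (λ t → (+ h -ᶻ + (t + 1) *ᶻ + γ′) %′ (t * t ∸ 1)) q≡Q)
                (trans (cong (λ t → (+ h -ᶻ + t *ᶻ + γ′) %′ M) (+-comm Q 1)) (%′≡%ℕ xₙ M))

    Nₕ<M : Nₕ < M
    Nₕ<M = subst (_< M) (sym Nₕ≡) (ℤD.n%ℕd<d xₙ M)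

    kₙ : ℤ
    kₙ = xₙ ℤ./ℕ M

    +h≡ : + h ≡ + Nₕ +ᶻ kₙ *ᶻ (+ Q₀ *ᶻ + suc Q) +ᶻ + suc Q *ᶻ + γ′
    +h≡ = begin
      + h                                                ≡⟨ unshift (+ h) (+ suc Q *ᶻ + γ′) ⟩
      (+ h -ᶻ + suc Q *ᶻ + γ′) +ᶻ + suc Q *ᶻ + γ′         ≡⟨ cong (_+ᶻ + suc Q *ᶻ + γ′) (ℤD.a≡a%ℕn+[a/ℕn]*n xₙ M) ⟩
      + (xₙ ℤ.%ℕ M) +ᶻ kₙ *ᶻ + M +ᶻ + suc Q *ᶻ + γ′         ≡⟨ cong₂ (λ x y → + x +ᶻ kₙ *ᶻ y +ᶻ + suc Q *ᶻ + γ′) (sym Nₕ≡) +M≡+Q₀*+[1+Q] ⟩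
      + Nₕ +ᶻ kₙ *ᶻ (+ Q₀ *ᶻ + suc Q) +ᶻ + suc Q *ᶻ + γ′ ∎
      where
      open ≡-Reasoning
      unshift : ∀ x a → x ≡ (x -ᶻ a) +ᶻ a
      unshift = ℤR.solve-∀

    Sₕ≡ : Sₕ ≡ (+ h -ᶻ + 1) ℤ.%ℕ suc Q
    Sₕ≡ = trans (cong (λ t → (+ h -ᶻ + 1) %′ (t + 1)) q≡Q) (trans (cong ((+ h -ᶻ + 1) %′_) (+-comm Q 1)) (%′≡%ℕ xₛ (suc Q)))

    kₛ : ℤ
    kₛ = xₛ ℤ./ℕ suc Q

    +h-1≡ : + h -ᶻ + 1 ≡ + Sₕ +ᶻ kₛ *ᶻ + suc Q
    +h-1≡ = trans (ℤD.a≡a%ℕn+[a/ℕn]*n xₛ (suc Q)) (cong (λ t → + t +ᶻ kₛ *ᶻ + suc Q) (sym Sₕ≡))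

    Sₕ<Q : Sₕ < Q
    Sₕ<Q = ≤∧≢⇒< (≤-pred (subst (_< suc Q) (sym Sₕ≡) (ℤD.n%ℕd<d xₛ (suc Q)))) λ S≡Q → Q+1∤ᶻh (kₛ +ᶻ + 1) (begin
      + h                                   ≡⟨ unshift (+ h) ⟩
      (+ h -ᶻ + 1) +ᶻ + 1                   ≡⟨ cong (_+ᶻ + 1) +h-1≡ ⟩
      + Sₕ +ᶻ kₛ *ᶻ + suc Q +ᶻ + 1          ≡⟨ cong (λ t → + t +ᶻ kₛ *ᶻ + suc Q +ᶻ + 1) S≡Q ⟩
      + Q +ᶻ kₛ *ᶻ + suc Q +ᶻ + 1           ≡⟨ cong (λ t → + Q +ᶻ kₛ *ᶻ t +ᶻ + 1) (ℤP.pos-+ 1 Q) ⟩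
      + Q +ᶻ kₛ *ᶻ (+ 1 +ᶻ + Q) +ᶻ + 1      ≡⟨ factor (+ Q) kₛ ⟩
      (+ 1 +ᶻ + Q) *ᶻ (kₛ +ᶻ + 1)           ≡⟨ cong (_*ᶻ (kₛ +ᶻ + 1)) (sym (ℤP.pos-+ 1 Q)) ⟩
      + suc Q *ᶻ (kₛ +ᶻ + 1)                ∎)
      where
      open ≡-Reasoning
      unshift : ∀ x → x ≡ (x -ᶻ + 1) +ᶻ + 1
      unshift = ℤR.solve-∀
      factor : ∀ x k → x +ᶻ k *ᶻ (+ 1 +ᶻ x) +ᶻ + 1 ≡ (+ 1 +ᶻ x) *ᶻ (k +ᶻ + 1)
      factor = ℤR.solve-∀

    Q+1∤Nₕ : ∀ c → Nₕ ≢ c * suc Q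
    Q+1∤Nₕ c eq = Q+1∤ᶻh (+ c +ᶻ kₙ *ᶻ + Q₀ +ᶻ + γ′) (begin
      + h                                                    ≡⟨ +h≡ ⟩
      + Nₕ +ᶻ kₙ *ᶻ (+ Q₀ *ᶻ + suc Q) +ᶻ + suc Q *ᶻ + γ′     ≡⟨ cong (λ t → t +ᶻ kₙ *ᶻ (+ Q₀ *ᶻ + suc Q) +ᶻ + suc Q *ᶻ + γ′)
                                                                 (trans (cong +_ eq) (ℤP.pos-* c (suc Q))) ⟩
      + c *ᶻ + suc Q +ᶻ kₙ *ᶻ (+ Q₀ *ᶻ + suc Q) +ᶻ + suc Q *ᶻ + γ′ ≡⟨ factor (+ c) kₙ (+ Q₀) (+ suc Q) (+ γ′) ⟩
      + suc Q *ᶻ (+ c +ᶻ kₙ *ᶻ + Q₀ +ᶻ + γ′)                 ∎)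
      where
      open ≡-Reasoning
      factor : ∀ c k m n g → c *ᶻ n +ᶻ k *ᶻ (m *ᶻ n) +ᶻ n *ᶻ g ≡ n *ᶻ (c +ᶻ k *ᶻ m +ᶻ g)
      factor = ℤR.solve-∀

    W : ℕ → ℕ
    W e = rot Nₕ e

    a b : ℕ → ℕ
    a e = W e / Q
    b e = W e % Q

    W≡a*Q+b : ∀ e → W e ≡ a e * Q + b e
    W≡a*Q+b e = trans (m≡m%n+[m/n]*n (W e) Q) (+-comm (b e) (a e * Q))

    a<Q : ∀ e → a e < Q
    a<Q e = m<n*o⇒m/o<n (<-trans (m%n<n (p ^ e * Nₕ) M) ≤-refl)

    b<Q : ∀ e → b e < Q
    b<Q e = m%n<n (W e) Q

    -- If a = b then W ≡ 0 (mod Q + 1), and multiplying back by p^(K - e) ≡ p^(-e) gives Q + 1 ∣ N.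
    a≢b : ∀ e → a e ≢ b e
    a≢b e a≡b = a≢b-below-K (e % K) (m%n<n e K) (subst (λ t → t / Q ≡ t % Q) (sym (rot-%K Nₕ e)) a≡b)
      where
      a≢b-below-K : ∀ e → e < K → a e ≢ b e
      a≢b-below-K e e<K a≡b = Q+1∤Nₕ (_∣_.quotient Q+1∣Nₕ) (_∣_.equality Q+1∣Nₕ)
        where
        s = K ∸ e
        u = (p ^ e * Nₕ) / M
        p^e*N≡ : p ^ e * Nₕ ≡ a e * suc Q + u * M
        p^e*N≡ = begin
          p ^ e * Nₕ            ≡⟨ m≡m%n+[m/n]*n (p ^ e * Nₕ) M ⟩
          W e + u * M           ≡⟨ cong (_+ u * M) (trans (W≡a*Q+b e) (cong (λ t → a e * Q + t) (sym a≡b))) ⟩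
          a e * Q + a e + u * M ≡⟨ cong (_+ u * M) (trans (+-comm (a e * Q) (a e)) (sym (*-suc (a e) Q))) ⟩
          a e * suc Q + u * M   ∎
          where open ≡-Reasoning
        expand : ∀ n m → n + suc (suc m) * (m * n) ≡ suc (m * suc (suc m)) * n
        expand = solve-∀
        factor : ∀ x a u m → x * (a * suc (suc m) + u * (m * suc (suc m))) ≡ suc (suc m) * (x * a + x * u * m)
        factor = solve-∀
        multiple : Nₕ + suc Q * (Q₀ * Nₕ) ≡ suc Q * (p ^ s * a e + p ^ s * u * Q₀)
        multiple = begin
          Nₕ + suc Q * (Q₀ * Nₕ)            ≡⟨ expand Nₕ Q₀ ⟩
          suc (Q₀ * suc Q) * Nₕ             ≡⟨ cong (λ t → suc t * Nₕ) (sym M≡Q₀*[2+Q₀]) ⟩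
          suc M * Nₕ                        ≡⟨ cong (_* Nₕ) (sym p^K≡Q*Q) ⟩
          p ^ K * Nₕ                        ≡⟨ cong (λ t → p ^ t * Nₕ) (sym (m+[n∸m]≡n (<⇒≤ e<K))) ⟩
          p ^ (e + s) * Nₕ                  ≡⟨ cong (_* Nₕ) (trans (^-distribˡ-+-* p e s) (*-comm (p ^ e) (p ^ s))) ⟩
          p ^ s * p ^ e * Nₕ                ≡⟨ *-assoc (p ^ s) (p ^ e) Nₕ ⟩
          p ^ s * (p ^ e * Nₕ)              ≡⟨ cong (p ^ s *_) p^e*N≡ ⟩
          p ^ s * (a e * suc Q + u * M)     ≡⟨ cong (λ t → p ^ s * (a e * suc Q + u * t)) M≡Q₀*[2+Q₀] ⟩
          p ^ s * (a e * suc Q + u * (Q₀ * suc Q)) ≡⟨ factor (p ^ s) (a e) u Q₀ ⟩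
          suc Q * (p ^ s * a e + p ^ s * u * Q₀) ∎
          where open ≡-Reasoning
        Q+1∣Nₕ : suc Q ∣ Nₕ
        Q+1∣Nₕ = ∣m+n∣m⇒∣n (subst (suc Q ∣_) (trans (sym multiple) (+-comm Nₕ (suc Q * (Q₀ * Nₕ)))) (m∣m*n (p ^ s * a e + p ^ s * u * Q₀))) (m∣m*n (Q₀ * Nₕ))

    W≢0 : ∀ e → W e ≢ 0
    W≢0 e W≡0 = a≢b e (trans (cong (_/ Q) W≡0) (cong (_% Q) (sym W≡0)))

    W≡R+k*M⇒W≡R : ∀ e {x R} k → x ≡ R + k * M → W e ≡ x % M → R ≤ M → W e ≡ R
    W≡R+k*M⇒W≡R e {x} k x≡ W≡x%M R≤M = trans W≡x%M (x≡r+k*m⇒x%m≢0⇒x%m≡r k R≤M x≡ (λ x%M≡0 → W≢0 e (trans W≡x%M x%M≡0)))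

    W-suc≡ : ∀ e → W (suc e) ≡ (b e % P * p + a e / P) + (a e % P * p + b e / P) * Q
    W-suc≡ e = trans (W≡R+k*M⇒W≡R (suc e) d p*W≡ W-suc (x*Q+y≤M A′<Q B′<Q)) (+-comm (A′ * Q) B′)
      where
      d = a e / P
      A′ = a e % P * p + b e / P
      B′ = b e % P * p + d
      A′<Q : A′ < Q
      A′<Q = x<P⇒x*p+y<Q (m%n<n (a e) P) (x<Q⇒x/P<p (b<Q e))
      B′<Q : B′ < Q
      B′<Q = x<P⇒x*p+y<Q (m%n<n (b e) P) (x<Q⇒x/P<p (a<Q e))
      W-suc : W (suc e) ≡ (p * W e) % M
      W-suc = trans (cong (rot Nₕ) (+-comm 1 e)) (trans (rot-+ Nₕ e 1) (cong (λ t → (t * W e) % M) (*-identityʳ p)))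
      rotate : ∀ p P d a′ c b′ → p * ((a′ + d * P) * (p * P) + (b′ + c * P)) + d
                                 ≡ ((a′ * p + c) * (p * P) + (b′ * p + d)) + d * ((p * P) * (p * P))
      rotate = solve-∀
      move-d : ∀ x d y → x + (d + y) ≡ x + y + d
      move-d = solve-∀
      p*W≡ : p * W e ≡ (A′ * Q + B′) + d * M
      p*W≡ = +-cancelʳ-≡ d _ _ (begin
        p * W e + d                                         ≡⟨ cong (λ t → p * t + d) (trans (W≡a*Q+b e)
                                                                 (cong₂ (λ x y → x * Q + y) (m≡m%n+[m/n]*n (a e) P) (m≡m%n+[m/n]*n (b e) P))) ⟩
        p * ((a e % P + d * P) * Q + (b e % P + b e / P * P)) + d ≡⟨ rotate p P d (a e % P) (b e / P) (b e % P) ⟩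
        (A′ * Q + B′) + d * suc M                           ≡⟨ cong (λ t → (A′ * Q + B′) + t) (*-suc d M) ⟩
        (A′ * Q + B′) + (d + d * M)                         ≡⟨ move-d (A′ * Q + B′) d (d * M) ⟩
        (A′ * Q + B′) + d * M + d                           ∎)
        where open ≡-Reasoning

    -- Writing a = a′ + dP and b = b′ + cP, multiplication by p sends aQ + b to (a′p + c)Q + (b′p + d).
    a-suc : ∀ e → a (suc e) ≡ (a e % P) * p + b e / P
    a-suc e = x≡r+k*m⇒x/m≡k (a e % P * p + b e / P) (x<P⇒x*p+y<Q (m%n<n (b e) P) (x<Q⇒x/P<p (a<Q e))) (W-suc≡ e)

    b-suc : ∀ e → b (suc e) ≡ (b e % P) * p + a e / P
    b-suc e = x≡r+k*m⇒x%m≡r (a e % P * p + b e / P) (x<P⇒x*p+y<Q (m%n<n (b e) P) (x<Q⇒x/P<p (a<Q e))) (W-suc≡ e)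

    W-+f≡ : ∀ e → W (e + f) ≡ a e + b e * Q
    W-+f≡ e = trans (W≡R+k*M⇒W≡R (e + f) (a e) Q*W≡ W-+f (x*Q+y≤M (b<Q e) (a<Q e))) (+-comm (b e * Q) (a e))
      where
      W-+f : W (e + f) ≡ (Q * W e) % M
      W-+f = trans (rot-+ Nₕ e f) (cong (λ t → (t * W e) % M) q≡Q)
      distrib : ∀ Q a b → Q * (a * Q + b) ≡ a * (Q * Q) + b * Q
      distrib = solve-∀
      regroup : ∀ a M b Q → a * suc M + b * Q ≡ (b * Q + a) + a * M
      regroup = solve-∀
      Q*W≡ : Q * W e ≡ (b e * Q + a e) + a e * M
      Q*W≡ = begin
        Q * W e                        ≡⟨ cong (Q *_) (W≡a*Q+b e) ⟩
        Q * (a e * Q + b e)            ≡⟨ distrib Q (a e) (b e) ⟩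
        a e * (Q * Q) + b e * Q        ≡⟨ regroup (a e) M (b e) Q ⟩
        (b e * Q + a e) + a e * M      ∎
        where open ≡-Reasoning

    a-+f : ∀ e → a (e + f) ≡ b e
    a-+f e = x≡r+k*m⇒x/m≡k (b e) (a<Q e) (W-+f≡ e)

    b-+f : ∀ e → b (e + f) ≡ a e
    b-+f e = x≡r+k*m⇒x%m≡r (b e) (a<Q e) (W-+f≡ e)

    uᵣ : ℕ → ℕ
    uᵣ j = (p ^ j * Nₕ) / M

    -- Reducing p^j h = p^j N + p^j kₙ (q² - 1) + (q + 1) p^j γ′ modulo q + 1.
    +⌊p^j*h/[1+Q]⌋≡ : ∀ j → + ((p ^ j * h) / suc Q)
                              ≡ + (W j / suc Q) +ᶻ (+ uᵣ j +ᶻ + (p ^ j) *ᶻ kₙ) *ᶻ + Q₀ +ᶻ + (p ^ j) *ᶻ + γ′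
    +⌊p^j*h/[1+Q]⌋≡ j = +x≡+r+k*m⇒+[x/m]≡k _ (m%n<n (W j) (suc Q)) (begin
      + (p ^ j * h)                                                        ≡⟨ ℤP.pos-* (p ^ j) h ⟩
      X *ᶻ + h                                                             ≡⟨ cong (X *ᶻ_) +h≡ ⟩
      X *ᶻ (+ Nₕ +ᶻ kₙ *ᶻ (+ Q₀ *ᶻ + suc Q) +ᶻ + suc Q *ᶻ + γ′)            ≡⟨ distrib X (+ Nₕ) kₙ (+ Q₀) (+ suc Q) (+ γ′) ⟩
      X *ᶻ + Nₕ +ᶻ (X *ᶻ kₙ) *ᶻ (+ Q₀ *ᶻ + suc Q) +ᶻ + suc Q *ᶻ (X *ᶻ + γ′) ≡⟨ cong (λ w → w +ᶻ (X *ᶻ kₙ) *ᶻ (+ Q₀ *ᶻ + suc Q) +ᶻ + suc Q *ᶻ (X *ᶻ + γ′)) X*N≡ ⟩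
      + ρ +ᶻ + s *ᶻ + suc Q +ᶻ + uᵣ j *ᶻ (+ Q₀ *ᶻ + suc Q) +ᶻ (X *ᶻ kₙ) *ᶻ (+ Q₀ *ᶻ + suc Q) +ᶻ + suc Q *ᶻ (X *ᶻ + γ′)
                                                                           ≡⟨ regroup (+ ρ) (+ s) (+ suc Q) (+ uᵣ j) (+ Q₀) X kₙ (+ γ′) ⟩
      + ρ +ᶻ (+ s +ᶻ (+ uᵣ j +ᶻ X *ᶻ kₙ) *ᶻ + Q₀ +ᶻ X *ᶻ + γ′) *ᶻ + suc Q  ∎)
      where
      open ≡-Reasoning
      X = + (p ^ j)
      s = W j / suc Q
      ρ = W j % suc Q
      distrib : ∀ X N k m n g → X *ᶻ (N +ᶻ k *ᶻ (m *ᶻ n) +ᶻ n *ᶻ g) ≡ X *ᶻ N +ᶻ (X *ᶻ k) *ᶻ (m *ᶻ n) +ᶻ n *ᶻ (X *ᶻ g)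
      distrib = ℤR.solve-∀
      regroup : ∀ ρ s n u m X k g → ρ +ᶻ s *ᶻ n +ᶻ u *ᶻ (m *ᶻ n) +ᶻ (X *ᶻ k) *ᶻ (m *ᶻ n) +ᶻ n *ᶻ (X *ᶻ g)
                                     ≡ ρ +ᶻ (s +ᶻ (u +ᶻ X *ᶻ k) *ᶻ m +ᶻ X *ᶻ g) *ᶻ n
      regroup = ℤR.solve-∀
      p^j*N≡ : p ^ j * Nₕ ≡ ρ + s * suc Q + uᵣ j * (Q₀ * suc Q)
      p^j*N≡ = trans (m≡m%n+[m/n]*n (p ^ j * Nₕ) M)
                 (cong₂ (λ x y → x + uᵣ j * y) (m≡m%n+[m/n]*n (W j) (suc Q)) M≡Q₀*[2+Q₀])
      X*N≡ : X *ᶻ + Nₕ ≡ + ρ +ᶻ + s *ᶻ + suc Q +ᶻ + uᵣ j *ᶻ (+ Q₀ *ᶻ + suc Q)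
      X*N≡ = begin
        X *ᶻ + Nₕ                                         ≡⟨ sym (ℤP.pos-* (p ^ j) Nₕ) ⟩
        + (p ^ j * Nₕ)                                    ≡⟨ cong +_ p^j*N≡ ⟩
        + (ρ + s * suc Q + uᵣ j * (Q₀ * suc Q))           ≡⟨ ℤP.pos-+ (ρ + s * suc Q) (uᵣ j * (Q₀ * suc Q)) ⟩
        + (ρ + s * suc Q) +ᶻ + (uᵣ j * (Q₀ * suc Q))      ≡⟨ cong₂ _+ᶻ_ (+[r+k*m]≡+r+ᶻ+k*ᶻ+m ρ s (suc Q))
                                                               (trans (ℤP.pos-* (uᵣ j) (Q₀ * suc Q)) (cong (+ uᵣ j *ᶻ_) (ℤP.pos-* Q₀ (suc Q)))) ⟩
        + ρ +ᶻ + s *ᶻ + suc Q +ᶻ + uᵣ j *ᶻ (+ Q₀ *ᶻ + suc Q) ∎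

    α≡W/[1+Q] : ∀ j → α p f h γ′ j ≡ W j / suc Q
    α≡W/[1+Q] j = begin
      α p f h γ′ j                                   ≡⟨ cong (λ t → (+ ((p ^ j * h) /′ (t + 1)) -ᶻ + (p ^ j * γ′)) %′ (t ∸ 1)) q≡Q ⟩
      (+ ((p ^ j * h) /′ (Q + 1)) -ᶻ + (p ^ j * γ′)) %′ Q₀ ≡⟨ cong (λ t → (+ ((p ^ j * h) /′ t) -ᶻ + (p ^ j * γ′)) %′ Q₀) (+-comm Q 1) ⟩
      x %′ Q₀                                        ≡⟨ %′≡%ℕ x Q₀ ⟩
      x ℤ.%ℕ Q₀                                      ≡⟨ i≡+r+k*m⇒i%ℕm≡r x s (+ uᵣ j +ᶻ + (p ^ j) *ᶻ kₙ) s<Q₀ x≡ ⟩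
      s                                              ∎
      where
      open ≡-Reasoning
      x = + ((p ^ j * h) / suc Q) -ᶻ + (p ^ j * γ′)
      s = W j / suc Q
      s<Q₀ : s < Q₀
      s<Q₀ = m<n*o⇒m/o<n {W j} {Q₀} {suc Q} (subst (W j <_) M≡Q₀*[2+Q₀] (m%n<n (p ^ j * Nₕ) M))
      cancel-γ′ : ∀ s k m g → s +ᶻ k *ᶻ m +ᶻ g -ᶻ g ≡ s +ᶻ k *ᶻ m
      cancel-γ′ = ℤR.solve-∀
      x≡ : x ≡ + s +ᶻ (+ uᵣ j +ᶻ + (p ^ j) *ᶻ kₙ) *ᶻ + Q₀
      x≡ = trans (cong₂ _-ᶻ_ (+⌊p^j*h/[1+Q]⌋≡ j) (ℤP.pos-* (p ^ j) γ′))
                 (cancel-γ′ (+ s) (+ uᵣ j +ᶻ + (p ^ j) *ᶻ kₙ) (+ Q₀) (+ (p ^ j) *ᶻ + γ′))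

    α-spec : ∀ j → IsAlpha (a j) (b j) (α p f h γ′ j)
    α-spec j = (λ b<a → trans (cong suc α≡) (b<a⇒1+[a*q+b]/[1+q]≡a Q (a j) (b j) (a<Q j) b<a))
             , (λ a≤b → trans α≡ (a≤b⇒[a*q+b]/[1+q]≡a Q (a j) (b j) (b<Q j) a≤b))
      where
      α≡ : α p f h γ′ j ≡ (a j * Q + b j) / suc Q
      α≡ = trans (α≡W/[1+Q] j) (cong (_/ suc Q) (W≡a*Q+b j))

    H : ℕ
    H = suc Sₕ * Q₀

    H≡[Q₀∸S]+S*Q : H ≡ (Q₀ ∸ Sₕ) + Sₕ * Q
    H≡[Q₀∸S]+S*Q = s≤m⇒[1+s]*m≡[m∸s]+s*[1+m] Sₕ Q₀ (≤-pred Sₕ<Q)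

    H<M : H < M
    H<M = subst (H <_) (sym M≡Q₀*[2+Q₀]) (begin-strict
      suc Sₕ * Q₀       ≡⟨ *-comm (suc Sₕ) Q₀ ⟩
      Q₀ * suc Sₕ       <⟨ *-monoʳ-< Q₀ (s≤s (s≤s (≤-pred Sₕ<Q))) ⟩
      Q₀ * suc (suc Q₀) ∎)
      where open ≤-Reasoning

    H/Q≡S : H / Q ≡ Sₕ
    H/Q≡S = x≡r+k*m⇒x/m≡k Sₕ (s≤s (m∸n≤m Q₀ Sₕ)) H≡[Q₀∸S]+S*Q

    -- H = Sq + (q - 1 - S): its high f base-p digits are those of S, its low ones their complements.
    hlow≡digit-H : ∀ e → e < f → hlow p f h γ′ e ≡ (H /p^ (K ∸ 1 ∸ e)) % p
    hlow≡digit-H e e<f = begin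
      (Sₕ /′ (p ^ w)) %ₙ p                  ≡⟨ trans (%ₙ≡% (Sₕ /′ (p ^ w)) p) (cong (_% p) (/′≡/ Sₕ (p ^ w) {{p^≢0 w}})) ⟩
      (Sₕ /p^ w) % p                        ≡⟨ cong (λ t → (t /p^ w) % p) (sym H/Q≡S) ⟩
      ((H / Q) /p^ w) % p                   ≡⟨ cong (_% p) (m/n/o≡m/[n*o] H Q (p ^ w) {{_}} {{p^≢0 w}} {{Q*p^w≢0}}) ⟩
      (_/_ H (Q * p ^ w) {{Q*p^w≢0}}) % p   ≡⟨ cong (_% p) (/-congʳ {{Q*p^w≢0}} {{p^≢0 (K ∸ 1 ∸ e)}} Q*p^w≡p^[K∸1∸e]) ⟩
      (H /p^ (K ∸ 1 ∸ e)) % p               ∎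
      where
      open ≡-Reasoning
      w = f ∸ 1 ∸ e
      Q*p^w≢0 : NonZero (Q * p ^ w)
      Q*p^w≢0 = m*n≢0 Q (p ^ w) {{_}} {{p^≢0 w}}
      Q*p^w≡p^[K∸1∸e] : Q * p ^ w ≡ p ^ (K ∸ 1 ∸ e)
      Q*p^w≡p^[K∸1∸e] = trans (cong (_* p ^ w) (sym q≡Q)) (trans (sym (^-distribˡ-+-* p f w))
        (cong (p ^_) (trans (sym (+-∸-assoc f (≤-pred e<f))) (cong (_∸ e) (sym K∸1≡f+[f∸1])))))

    p∸1∸hlow≡digit-H : ∀ e → e < K → f ≤ e → p ∸ 1 ∸ hlow p f h γ′ (e ∸ f) ≡ (H /p^ (K ∸ 1 ∸ e)) % p
    p∸1∸hlow≡digit-H e e<K f≤e = begin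
      p ∸ 1 ∸ (Sₕ /′ (p ^ w)) %ₙ p                   ≡⟨ cong (p ∸ 1 ∸_) (trans (%ₙ≡% (Sₕ /′ (p ^ w)) p) (cong (_% p) (/′≡/ Sₕ (p ^ w) {{p^≢0 w}}))) ⟩
      p ∸ 1 ∸ (Sₕ /p^ w) % p                         ≡⟨ sym ([[b^[1+k]*m∸1∸s]/m]%b≡b∸1∸[s/m]%b p k (p ^ w) Sₕ {{_}} {{p^≢0 w}} S<p^[1+k]*p^w) ⟩
      ((p ^ suc k * p ^ w ∸ 1 ∸ Sₕ) /p^ w) % p       ≡⟨ cong (λ t → ((t ∸ 1 ∸ Sₕ) /p^ w) % p) p^[1+k]*p^w≡Q ⟩
      ((Q₀ ∸ Sₕ) /p^ w) % p                          ≡⟨ sym ([m+kn]%n≡m%n ((Q₀ ∸ Sₕ) /p^ w) (Sₕ * p ^ k) p) ⟩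
      ((Q₀ ∸ Sₕ) /p^ w + Sₕ * p ^ k * p) % p         ≡⟨ cong (λ t → ((Q₀ ∸ Sₕ) /p^ w + t) % p) (trans (*-assoc Sₕ (p ^ k) p) (cong (Sₕ *_) (*-comm (p ^ k) p))) ⟩
      ((Q₀ ∸ Sₕ) /p^ w + Sₕ * p ^ suc k) % p         ≡⟨ cong (_% p) (sym ([x+s*[n*m]]/m≡x/m+s*n (Q₀ ∸ Sₕ) Sₕ (p ^ suc k) (p ^ w) {{p^≢0 w}})) ⟩
      ((Q₀ ∸ Sₕ + Sₕ * (p ^ suc k * p ^ w)) /p^ w) % p ≡⟨ cong (λ t → ((Q₀ ∸ Sₕ + Sₕ * t) /p^ w) % p) p^[1+k]*p^w≡Q ⟩
      ((Q₀ ∸ Sₕ + Sₕ * Q) /p^ w) % p                 ≡⟨ cong (λ t → (t /p^ w) % p) (sym H≡[Q₀∸S]+S*Q) ⟩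
      (H /p^ w) % p                                  ≡⟨ cong (λ t → (H /p^ t) % p) (sym K∸1∸e≡w) ⟩
      (H /p^ (K ∸ 1 ∸ e)) % p                        ∎
      where
      open ≡-Reasoning
      k = e ∸ f
      w = f ∸ 1 ∸ k
      e≡f+k : e ≡ f + k
      e≡f+k = sym (m+[n∸m]≡n f≤e)
      k<f : k < f
      k<f = +-cancelˡ-< f k f (subst (_< f + f) e≡f+k (subst (e <_) (cong (λ t → f + t) (+-identityʳ f)) e<K))
      K∸1∸e≡w : K ∸ 1 ∸ e ≡ w
      K∸1∸e≡w = trans (cong₂ _∸_ K∸1≡f+[f∸1] e≡f+k) ([m+n]∸[m+o]≡n∸o f (f ∸ 1) k)
      1+k+w≡f : suc k + w ≡ f
      1+k+w≡f = trans (+-comm (suc k) w) (trans (cong (_+ suc k) (∸-+-assoc f 1 k)) (m∸n+n≡m {f} {suc k} k<f))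
      p^[1+k]*p^w≡Q : p ^ suc k * p ^ w ≡ Q
      p^[1+k]*p^w≡Q = trans (sym (^-distribˡ-+-* p (suc k) w)) (trans (cong (p ^_) 1+k+w≡f) q≡Q)
      S<p^[1+k]*p^w : Sₕ < p ^ suc k * p ^ w
      S<p^[1+k]*p^w = subst (Sₕ <_) (sym p^[1+k]*p^w≡Q) Sₕ<Q

    hdigit≡digit-H : ∀ i → hdigit p f h γ′ i ≡ (H /p^ (K ∸ 1 ∸ red p f i)) % p
    hdigit≡digit-H i with red p f i <ᵇ f in e<ᵇf
    ... | true  = hlow≡digit-H (red p f i) (<ᵇ⇒< (red p f i) f (subst T (sym e<ᵇf) tt))
    ... | false = p∸1∸hlow≡digit-H (red p f i) (red<K i) (≮⇒≥ λ e<f → subst T e<ᵇf (<⇒<ᵇ e<f))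

    H%M≡[Q₀*N]%M : H % M ≡ (Q₀ * Nₕ) % M
    H%M≡[Q₀*N]%M = +x≡+y+k*m⇒x%m≡y%m H (Q₀ * Nₕ) (kₙ *ᶻ + Q₀ +ᶻ + γ′ -ᶻ kₛ) (begin
      + H                                                                  ≡⟨ ℤP.pos-* (suc Sₕ) Q₀ ⟩
      + suc Sₕ *ᶻ + Q₀                                                     ≡⟨ cong (_*ᶻ + Q₀) +[1+S]≡ ⟩
      (+ h -ᶻ kₛ *ᶻ + suc Q) *ᶻ + Q₀                                       ≡⟨ cong (λ t → (t -ᶻ kₛ *ᶻ + suc Q) *ᶻ + Q₀) +h≡ ⟩
      (+ Nₕ +ᶻ kₙ *ᶻ (+ Q₀ *ᶻ + suc Q) +ᶻ + suc Q *ᶻ + γ′ -ᶻ kₛ *ᶻ + suc Q) *ᶻ + Q₀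
                                                                           ≡⟨ regroup (+ Nₕ) kₙ (+ Q₀) (+ suc Q) (+ γ′) kₛ ⟩
      + Q₀ *ᶻ + Nₕ +ᶻ (kₙ *ᶻ + Q₀ +ᶻ + γ′ -ᶻ kₛ) *ᶻ (+ Q₀ *ᶻ + suc Q)       ≡⟨ cong₂ (λ x y → x +ᶻ (kₙ *ᶻ + Q₀ +ᶻ + γ′ -ᶻ kₛ) *ᶻ y)
                                                                                (sym (ℤP.pos-* Q₀ Nₕ)) (sym +M≡+Q₀*+[1+Q]) ⟩
      + (Q₀ * Nₕ) +ᶻ (kₙ *ᶻ + Q₀ +ᶻ + γ′ -ᶻ kₛ) *ᶻ + M                      ∎)
      where
      open ≡-Reasoning
      shift : ∀ s k n → + 1 +ᶻ s ≡ + 1 +ᶻ (s +ᶻ k *ᶻ n) -ᶻ k *ᶻ n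
      shift = ℤR.solve-∀
      cancel-1 : ∀ x k n → + 1 +ᶻ (x -ᶻ + 1) -ᶻ k *ᶻ n ≡ x -ᶻ k *ᶻ n
      cancel-1 = ℤR.solve-∀
      regroup : ∀ N k m n g l → (N +ᶻ k *ᶻ (m *ᶻ n) +ᶻ n *ᶻ g -ᶻ l *ᶻ n) *ᶻ m ≡ m *ᶻ N +ᶻ (k *ᶻ m +ᶻ g -ᶻ l) *ᶻ (m *ᶻ n)
      regroup = ℤR.solve-∀
      +[1+S]≡ : + suc Sₕ ≡ + h -ᶻ kₛ *ᶻ + suc Q
      +[1+S]≡ = begin
        + suc Sₕ                                ≡⟨ ℤP.pos-+ 1 Sₕ ⟩
        + 1 +ᶻ + Sₕ                             ≡⟨ shift (+ Sₕ) kₛ (+ suc Q) ⟩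
        + 1 +ᶻ (+ Sₕ +ᶻ kₛ *ᶻ + suc Q) -ᶻ kₛ *ᶻ + suc Q ≡⟨ cong (λ t → + 1 +ᶻ t -ᶻ kₛ *ᶻ + suc Q) (sym +h-1≡) ⟩
        + 1 +ᶻ (+ h -ᶻ + 1) -ᶻ kₛ *ᶻ + suc Q    ≡⟨ cancel-1 (+ h) kₛ (+ suc Q) ⟩
        + h -ᶻ kₛ *ᶻ + suc Q                    ∎

    rot-H≡ : ∀ e → rot H e ≡ (Q₀ * (a e * Q + b e)) % M
    rot-H≡ e = begin
      rot H e                          ≡⟨ rot-cong H%M≡[Q₀*N]%M e ⟩
      (p ^ e * (Q₀ * Nₕ)) % M          ≡⟨ cong (_% M) (x*[y*z]≡y*[x*z] (p ^ e) Q₀ Nₕ) ⟩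
      (Q₀ * (p ^ e * Nₕ)) % M          ≡⟨ [m*n]%o≡[m*[n%o]]%o Q₀ (p ^ e * Nₕ) M ⟩
      (Q₀ * W e) % M                   ≡⟨ cong (λ t → (Q₀ * t) % M) (W≡a*Q+b e) ⟩
      (Q₀ * (a e * Q + b e)) % M       ∎
      where
      open ≡-Reasoning
      x*[y*z]≡y*[x*z] : ∀ x y z → x * (y * z) ≡ y * (x * z)
      x*[y*z]≡y*[x*z] = solve-∀

    ι-Bit : ∀ i → Bit (ι p f h γ′ i)
    ι-Bit i with hdigit p f h γ′ i ≡ᵇ r
    ... | true  = inj₂ refl
    ... | false = inj₁ refl

    hdigit≡r⇒ι≡1 : ∀ i → hdigit p f h γ′ i ≡ r → ι p f h γ′ i ≡ 1
    hdigit≡r⇒ι≡1 i d≡r with hdigit p f h γ′ i ≡ᵇ r in d≡ᵇr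
    ... | true  = refl
    ... | false = ⊥-elim (subst T d≡ᵇr (≡⇒≡ᵇ _ r d≡r))

    hdigit≢r⇒ι≡0 : ∀ i → hdigit p f h γ′ i ≢ r → ι p f h γ′ i ≡ 0
    hdigit≢r⇒ι≡0 i d≢r with hdigit p f h γ′ i ≡ᵇ r in d≡ᵇr
    ... | true  = ⊥-elim (d≢r (≡ᵇ⇒≡ _ r (subst T (sym d≡ᵇr) tt)))
    ... | false = refl

    -- rot H e ≡ (q - 1)(aq + b); its leading digit is p - 1 exactly in the cases listed by IsIota.
    IsIota-from-lead : ∀ i e → hdigit p f h γ′ i ≡ (rot H e / Q) / P → IsIota (a e) (b e) (ι p f h γ′ i)
    IsIota-from-lead i e d≡ = a<b-case , b<a-case
      where
      X = rot H e
      d≡X/QP : hdigit p f h γ′ i ≡ X / (Q * P)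
      d≡X/QP = trans d≡ (m/n/o≡m/[n*o] X Q P)
      lead-r : r * (Q * P) ≤ X → ι p f h γ′ i ≡ 1
      lead-r rQP≤X = hdigit≡r⇒ι≡1 i (trans d≡X/QP (r*QP≤x⇒x/QP≡r X (m%n<n (p ^ e * H) M) rQP≤X))
      lead-not-r : X < r * (Q * P) → ι p f h γ′ i ≡ 0
      lead-not-r X<rQP = hdigit≢r⇒ι≡0 i (λ d≡r → x<r*QP⇒x/QP≢r X X<rQP (trans (sym d≡X/QP) d≡r))
      a<b-case : a e < b e → (r * P < b e ∸ a e → ι p f h γ′ i ≡ 1) × (b e ∸ a e ≤ r * P → ι p f h γ′ i ≡ 0)
      a<b-case a<b = (λ rP<b∸a → lead-r (subst (r * (Q * P) ≤_) (sym X≡) (rP<d⇒r*QP≤d*Q₀ rP<b∸a)))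
                   , (λ b∸a≤rP → lead-not-r (subst (_< r * (Q * P)) (sym X≡) (d≤rP⇒d*Q₀<r*QP b∸a≤rP)))
        where
        X≡ : X ≡ (b e ∸ a e) * Q₀
        X≡ = trans (rot-H≡ e) (a<b⇒[m*[a*[1+m]+b]]%M≡[b∸a]*m Q₀ M M≡Q₀*[2+Q₀] (a e) (b e) a<b (b<Q e))
      b<a-case : b e < a e → (a e ∸ b e ≤ P → ι p f h γ′ i ≡ 1) × (P < a e ∸ b e → ι p f h γ′ i ≡ 0)
      b<a-case b<a = (λ a∸b≤P → lead-r (x+d*Q₀≡M⇒d≤P⇒r*QP≤x X+[a∸b]*Q₀≡M a∸b≤P))
                   , (λ P<a∸b → lead-not-r (x+d*Q₀≡M⇒P<d⇒x<r*QP X+[a∸b]*Q₀≡M P<a∸b))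
        where
        X+[a∸b]*Q₀≡M : X + (a e ∸ b e) * Q₀ ≡ M
        X+[a∸b]*Q₀≡M = trans (cong (_+ (a e ∸ b e) * Q₀) (rot-H≡ e))
                         (b<a⇒[m*[a*[1+m]+b]]%M+[a∸b]*m≡M Q₀ M M≡Q₀*[2+Q₀] (a e) (b e) b<a (a<Q e))

    hdigit≡lead-rot-H : ∀ e → hdigit p f h γ′ (+ e) ≡ (rot H e / Q) / P
    hdigit≡lead-rot-H e = trans (hdigit≡digit-H (+ e))
      (trans (digit≡lead-rot H H<M (e % K) (m%n<n e K)) (cong (λ t → (t / Q) / P) (rot-%K H e)))

    ι₀-spec : ∀ e → IsIota (a e) (b e) (ι p f h γ′ (+ e))
    ι₀-spec e = IsIota-from-lead (+ e) e (hdigit≡lead-rot-H e)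

    ιf-spec : ∀ e → IsIota (b e) (a e) (ι p f h γ′ (+ (e + f)))
    ιf-spec e = subst₂ (λ x y → IsIota x y (ι p f h γ′ (+ (e + f)))) (a-+f e) (b-+f e)
                  (IsIota-from-lead (+ (e + f)) (e + f) (hdigit≡lead-rot-H (e + f)))

    v≡a/P : ∀ i → v p f h γ′ i ≡ a (red p f i) / P
    v≡a/P i = trans (%ₙ≡% (Nₕ /′ (p ^ (K ∸ 1 ∸ e))) p)
      (trans (cong (_% p) (/′≡/ Nₕ (p ^ (K ∸ 1 ∸ e)) {{p^≢0 (K ∸ 1 ∸ e)}})) (digit≡lead-rot Nₕ Nₕ<M e (red<K i)))
      where e = red p f i

    W-red-+1 : ∀ i → W (red p f (i +ᶻ + 1)) ≡ W (suc (red p f i))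
    W-red-+1 i = trans (cong W (red-+ i 1)) (trans (rot-%K Nₕ (red p f i + 1)) (cong W (+-comm (red p f i) 1)))

    α-next-spec : ∀ i → let e = red p f i in
      IsAlpha (a e % P * p + b e / P) (b e % P * p + a e / P) (α p f h γ′ (red p f (i +ᶻ + 1)))
    α-next-spec i = subst₂ (λ x y → IsAlpha x y (α p f h γ′ (red p f (i +ᶻ + 1))))
      (trans (cong (_/ Q) (W-red-+1 i)) (a-suc (red p f i))) (trans (cong (_% Q) (W-red-+1 i)) (b-suc (red p f i)))
      (α-spec (red p f (i +ᶻ + 1)))

    αᵢ ι₀ᵢ ιfᵢ : ℤ → ℕ
    αᵢ i  = α p f h γ′ (red p f i)
    ι₀ᵢ i = ι p f h γ′ (+ red p f i)
    ιfᵢ i = ι p f h γ′ (+ (red p f i + f))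

    Classifiedᵢ : ℤ → Sym → Set
    Classifiedᵢ i = Classified (αᵢ i) (ι₀ᵢ i) (ιfᵢ i)

    NextDecidesᵢ : ℤ → Sym → Sym → Set
    NextDecidesᵢ i = NextDecides (αᵢ i) (ι₀ᵢ i) (ιfᵢ i) (αᵢ (i +ᶻ + 1))

    b≡[b/P]*P+b%P : ∀ e → b e ≡ b e / P * P + b e % P
    b≡[b/P]*P+b%P e = trans (m≡m%n+[m/n]*n (b e) P) (+-comm (b e % P) (b e / P * P))

    classify-v≡0 : ∀ i → v p f h γ′ i ≡ 0 → NextDecidesᵢ i A AB
    classify-v≡0 i v≡0 = classify-lead0 a<P (b≡[b/P]*P+b%P e) (m%n<n (b e) P) (x<Q⇒x/P<p (b<Q e)) (b<Q e) (a≢b e)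
      (α-spec e) (ι₀-spec e) (ιf-spec e) (ι-Bit (+ e)) (ι-Bit (+ (e + f))) α⁺-spec
      where
      e = red p f i
      a/P≡0 : a e / P ≡ 0
      a/P≡0 = trans (sym (v≡a/P i)) v≡0
      a<P : a e < P
      a<P = m/n≡0⇒m<n a/P≡0
      α⁺-spec : IsAlpha (a e * p + b e / P) (b e % P * p) (αᵢ (i +ᶻ + 1))
      α⁺-spec = subst₂ (λ x y → IsAlpha (x * p + b e / P) y (αᵢ (i +ᶻ + 1))) (m<n⇒m%n≡m a<P)
        (trans (cong (λ t → b e % P * p + t) a/P≡0) (+-identityʳ _)) (α-next-spec i)

    classify-v≡1 : ∀ i → v p f h γ′ i ≡ 1 → NextDecidesᵢ i B O
    classify-v≡1 i v≡1 = classify-lead1 {ιf = ιfᵢ i} (m%n<n (a e) P) (b≡[b/P]*P+b%P e) (m%n<n (b e) P) (x<Q⇒x/P<p (b<Q e))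
      (subst (_≢ b e) a≡P+a%P (a≢b e)) (subst (λ x → IsAlpha x (b e) (αᵢ i)) a≡P+a%P (α-spec e))
      (subst (λ x → IsIota x (b e) (ι₀ᵢ i)) a≡P+a%P (ι₀-spec e)) α⁺-spec
      where
      e = red p f i
      a/P≡1 : a e / P ≡ 1
      a/P≡1 = trans (sym (v≡a/P i)) v≡1
      a≡P+a%P : a e ≡ P + a e % P
      a≡P+a%P = x/P≡1⇒x≡P+x%P a/P≡1
      α⁺-spec : IsAlpha (a e % P * p + b e / P) (b e % P * p + 1) (αᵢ (i +ᶻ + 1))
      α⁺-spec = subst (λ t → IsAlpha (a e % P * p + b e / P) (b e % P * p + t) (αᵢ (i +ᶻ + 1))) a/P≡1 (α-next-spec i)

    classify-v≥2 : ∀ i → 2 ≤ v p f h γ′ i → Classifiedᵢ i O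
    classify-v≥2 i 2≤v = classify-lead≥2 {a e % P} {a e / P} {ι₀ = ι₀ᵢ i} {ιf = ιfᵢ i} (subst (2 ≤_) (v≡a/P i) 2≤v)
      (subst (λ x → IsAlpha x (b e) (αᵢ i)) (trans (m≡m%n+[m/n]*n (a e) P) (+-comm (a e % P) _)) (α-spec e))
      where e = red p f i

    a-b-suc : ∀ e → a e / P ≡ 1 → b e / P ≡ 1 → + a (suc e) -ᶻ + b (suc e) ≡ + p *ᶻ (+ a e -ᶻ + b e)
    a-b-suc e a/P≡1 b/P≡1 = begin
      + a (suc e) -ᶻ + b (suc e)               ≡⟨ cong₂ (λ x y → + x -ᶻ + y)
                                                    (trans (a-suc e) (cong (λ z → x * p + z) b/P≡1))
                                                    (trans (b-suc e) (cong (λ z → y * p + z) a/P≡1)) ⟩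
      + (x * p + 1) -ᶻ + (y * p + 1)           ≡⟨ cong₂ _-ᶻ_ (+[x*p+1]≡ x) (+[x*p+1]≡ y) ⟩
      + 1 +ᶻ + x *ᶻ + p -ᶻ (+ 1 +ᶻ + y *ᶻ + p) ≡⟨ factor (+ x) (+ y) (+ p) (+ P) ⟩
      + p *ᶻ ((+ P +ᶻ + x) -ᶻ (+ P +ᶻ + y))    ≡⟨ cong₂ (λ u w → + p *ᶻ (u -ᶻ w)) (sym (+[P+x%P] (a e) a/P≡1)) (sym (+[P+x%P] (b e) b/P≡1)) ⟩
      + p *ᶻ (+ a e -ᶻ + b e)                  ∎
      where
      open ≡-Reasoning
      x = a e % P
      y = b e % P
      factor : ∀ x y p P → + 1 +ᶻ x *ᶻ p -ᶻ (+ 1 +ᶻ y *ᶻ p) ≡ p *ᶻ ((P +ᶻ x) -ᶻ (P +ᶻ y))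
      factor = ℤR.solve-∀
      +[x*p+1]≡ : ∀ x → + (x * p + 1) ≡ + 1 +ᶻ + x *ᶻ + p
      +[x*p+1]≡ x = trans (cong +_ (+-comm (x * p) 1)) (+[r+k*m]≡+r+ᶻ+k*ᶻ+m 1 x p)
      +[P+x%P] : ∀ x → x / P ≡ 1 → + x ≡ + P +ᶻ + (x % P)
      +[P+x%P] x x/P≡1 = trans (cong +_ (x/P≡1⇒x≡P+x%P x/P≡1)) (ℤP.pos-+ P (x % P))

    a/P≡v : ∀ i t → a (red p f i + t) / P ≡ v p f h γ′ (i +ᶻ + (t % K))
    a/P≡v i t = begin
      a (e + t) / P                        ≡⟨ cong (λ x → a x / P) (trans (cong (λ x → e + x) (m≡m%n+[m/n]*n t K))
                                                (sym (+-assoc e (t % K) (t / K * K)))) ⟩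
      a (e + t % K + t / K * K) / P        ≡⟨ cong (λ w → (w / Q) / P) (rot-+k*K Nₕ (e + t % K) (t / K)) ⟩
      a (e + t % K) / P                    ≡⟨ cong (λ w → (w / Q) / P) (sym (rot-%K Nₕ (e + t % K))) ⟩
      a ((e + t % K) % K) / P              ≡⟨ cong (λ x → a x / P) (sym (red-+ i (t % K))) ⟩
      a (red p f (i +ᶻ + (t % K))) / P     ≡⟨ sym (v≡a/P (i +ᶻ + (t % K))) ⟩
      v p f h γ′ (i +ᶻ + (t % K))          ∎
      where
      open ≡-Reasoning
      e = red p f i

    -- If every digit were 1, a - b would be multiplied by p at each step while being 2f-periodic
    -- and nonzero, forcing p^(2f) = 1.
    ¬all-v≡1 : ∀ i → ¬ (∀ t → t < K → v p f h γ′ (i +ᶻ + t) ≡ 1)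
    ¬all-v≡1 i all-1 = <-irrefl (sym p^K≡1) (subst (1 <_) (sym p^K≡Q*Q) (s≤s (ℕ.>-nonZero⁻¹ M)))
      where
      e = red p f i
      a/P≡1 : ∀ t → a (e + t) / P ≡ 1
      a/P≡1 t = trans (a/P≡v i t) (all-1 (t % K) (m%n<n t K))
      b/P≡1 : ∀ t → b (e + t) / P ≡ 1
      b/P≡1 t = trans (cong (_/ P) (sym (a-+f (e + t)))) (trans (cong (λ x → a x / P) (+-assoc e t f)) (a/P≡1 (t + f)))
      δ : ℕ → ℤ
      δ t = + a (e + t) -ᶻ + b (e + t)
      δ≡p^t*δ0 : ∀ t → δ t ≡ + (p ^ t) *ᶻ δ 0
      δ≡p^t*δ0 zero    = sym (ℤP.*-identityˡ (δ 0))
      δ≡p^t*δ0 (suc t) = begin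
        δ (suc t)                     ≡⟨ cong (λ x → + a x -ᶻ + b x) (+-suc e t) ⟩
        + a (suc (e + t)) -ᶻ + b (suc (e + t)) ≡⟨ a-b-suc (e + t) (a/P≡1 t) (b/P≡1 t) ⟩
        + p *ᶻ δ t                    ≡⟨ cong (+ p *ᶻ_) (δ≡p^t*δ0 t) ⟩
        + p *ᶻ (+ (p ^ t) *ᶻ δ 0)     ≡⟨ sym (ℤP.*-assoc (+ p) (+ (p ^ t)) (δ 0)) ⟩
        + p *ᶻ + (p ^ t) *ᶻ δ 0       ≡⟨ cong (_*ᶻ δ 0) (sym (ℤP.pos-* p (p ^ t))) ⟩
        + (p ^ suc t) *ᶻ δ 0          ∎
        where open ≡-Reasoning
      δK≡δ0 : δ K ≡ δ 0
      δK≡δ0 = cong (λ w → + (w / Q) -ᶻ + (w % Q)) (trans (rot-+K Nₕ e) (cong W (sym (+-identityʳ e))))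
      δ0≢0 : δ 0 ≢ + 0
      δ0≢0 δ0≡0 = a≢b (e + 0) (ℤP.+-injective (ℤP.i-j≡0⇒i≡j (+ a (e + 0)) (+ b (e + 0)) δ0≡0))
      p^K≡1 : p ^ K ≡ 1
      p^K≡1 = ℤP.+-injective (ℤP.*-cancelʳ-≡ (+ (p ^ K)) (+ 1) (δ 0) {{ℤ.≢-nonZero δ0≢0}}
                (trans (sym (δ≡p^t*δ0 K)) (trans δK≡δ0 (sym (ℤP.*-identityˡ (δ 0))))))

    Classifiedᵢ-unique : ∀ i s t → Classifiedᵢ i s → Classifiedᵢ i t → s ≡ t
    Classifiedᵢ-unique i = Classified-unique (ι-Bit (+ red p f i)) (ι-Bit (+ (red p f i + f)))

    v≤p∸1 : ∀ i → v p f h γ′ i ≤ p ∸ 1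
    v≤p∸1 i = ≤-pred (subst (_< p) (sym (%ₙ≡% (Nₕ /′ (p ^ (K ∸ 1 ∸ red p f i))) p)) (m%n<n (Nₕ /′ (p ^ (K ∸ 1 ∸ red p f i))) p))

    G : ℤ → Sym
    G i = predict (v p f h γ′ i) (does (p * μ <? αᵢ (i +ᶻ + 1)))

    classify-predict : ∀ i (O? : Dec (p * μ < αᵢ (i +ᶻ + 1))) → Classifiedᵢ i (predict (v p f h γ′ i) (does O?))
    classify-predict i O? with ≡0⊎≡1⊎≥2 (v p f h γ′ i) | O?
    ... | inj₁ v≡0        | yes O⁺ = subst (λ w → Classifiedᵢ i (predict w true)) (sym v≡0) (proj₂ (classify-v≡0 i v≡0) O⁺)
    ... | inj₁ v≡0        | no ¬O⁺ = subst (λ w → Classifiedᵢ i (predict w false)) (sym v≡0) (proj₁ (classify-v≡0 i v≡0) (≮⇒≥ ¬O⁺))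
    ... | inj₂ (inj₁ v≡1) | yes O⁺ = subst (λ w → Classifiedᵢ i (predict w true)) (sym v≡1) (proj₂ (classify-v≡1 i v≡1) O⁺)
    ... | inj₂ (inj₁ v≡1) | no ¬O⁺ = subst (λ w → Classifiedᵢ i (predict w false)) (sym v≡1) (proj₁ (classify-v≡1 i v≡1) (≮⇒≥ ¬O⁺))
    ... | inj₂ (inj₂ 2≤v) | O?′    = subst (Classifiedᵢ i) (sym (2≤w⇒predict≡O _ (does O?′) 2≤v)) (classify-v≥2 i 2≤v)

    G-classified : ∀ i → Classifiedᵢ i (G i)
    G-classified i = classify-predict i (p * μ <? αᵢ (i +ᶻ + 1))

    G-follows : FollowsDigits (v p f h γ′) G
    G-follows i = cong (predict (v p f h γ′ i)) (O?≡isO-G (i +ᶻ + 1) (p * μ <? αᵢ (i +ᶻ + 1)))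
      where
      O?≡isO-G : ∀ i (O? : Dec (p * μ < αᵢ i)) → does O? ≡ isO (G i)
      O?≡isO-G i (yes O-here) = sym (≡O⇒isO≡true (Classifiedᵢ-unique i (G i) O (G-classified i) O-here))
      O?≡isO-G i (no ¬O-here) = sym (≢O⇒isO≡false λ G≡O → ¬O-here (subst (Classifiedᵢ i) G≡O (G-classified i)))

propositionB1p7 : (p f : ℕ) → Prime p → 2 < p → 2 ≤ f →
    (h γ γ′ : ℕ) → Coherent p f h γ γ′ →
    (X : ℤ → Sym) → IsGene f X →
    (GeneOfTripleIs p f h γ′ X → DigitConditions p f h γ′ X)
    × (DigitConditions p f h γ′ X → GeneOfTripleIs p f h γ′ X)
-- Primality of p and the value of γ play no role: only p ≥ 3, f ≥ 2 and q + 1 ∤ h are used.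
propositionB1p7 _ _ _ (s≤s (s≤s (s≤s {n = r₂} z≤n))) (s≤s (s≤s {n = f₂} z≤n)) h _ γ′ coherent X X-gene =
  gene⇒digits , digits⇒gene
  where
  open Setting r₂ f₂
  open Triple h γ′ (Coherent.h-not-div coherent)
  ι-Bit₀ : ∀ i → Bit (ι₀ᵢ i)
  ι-Bit₀ i = ι-Bit (+ red p f i)
  gene⇒digits : GeneOfTripleIs p f h γ′ X → DigitConditions p f h γ′ X
  gene⇒digits X-gene-of-triple i =
    predict⇒DigitCondition (v≤p∸1 i) (trans (X≡G i) (trans (G-follows i) (cong (λ s → predict (v p f h γ′ i) (isO s)) (sym (X≡G (i +ᶻ + 1))))))
    where
    X≡G : ∀ i → X i ≡ G i
    X≡G i = Classifiedᵢ-unique i (X i) (G i) (ClassifiedAs⇒Classified h γ′ (ι-Bit₀ i) (X i) (X-gene-of-triple i)) (G-classified i)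
  digits⇒gene : DigitConditions p f h γ′ X → GeneOfTripleIs p f h γ′ X
  digits⇒gene digits i = Classified⇒ClassifiedAs h γ′ (ι-Bit₀ i) (X i) (subst (Classifiedᵢ i) (sym (X≡G i)) (G-classified i))
    where
    X-follows : FollowsDigits (v p f h γ′) X
    X-follows i = DigitCondition⇒predict (X i) (X (i +ᶻ + 1)) (digits i)
      (λ X⁺≡O → subst (λ j → X j ≡ AB ⊎ X j ≡ O) ([i+1]-1≡i i) (IsGene.0-after X-gene (i +ᶻ + 1) X⁺≡O))
      (IsGene.ab-then-0 X-gene i)
    X≡G : ∀ i → X i ≡ G i
    X≡G = FollowsDigits-unique (v p f h γ′) K ¬all-v≡1 X-follows G-follows
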